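{- Let $n$ be an odd positive integer and let $G=G_1+G_2+\cdots+G_l$, where each $G_i$ is a unicyclic graph of the form $G_i=(T_1^i(w_1^i),T_2^i(w_2^i),\dots,T_{m_i}^i(w_{m_i}^i))$ with cycle of length $m_i$. Let $I=\{1,\dots,l\}$ and let $J\subseteq I$ be such that for every $i\in J$ with $m_i$ odd we have $m_i\ge n$. If $G$ has an edge-magic labeling (respectively, a super edge-magic labeling), then $$\Big(\sum_{j\in J}nG_j\Big)+\Big(\sum_{i\in I\setminus J}G_i^{n}\Big)$$ has an edge-magic labeling (respectively, a super edge-magic labeling).
   Context: All graphs are simple. Notation: for trees $T_1,\dots,T_m$ and $w_j\in V(T_j)$, $(T_1(w_1),\dots,T_m(w_m))$ is the unicyclic graph obtained from a cycle $a_1\cdots a_m$ and disjoint copies of the $T_j$ by identifying $w_j$ with $a_j$. For such a graph $H$ and $k\ge1$, $H^k$ denotes $(T_1(w_1),\dots,T_m(w_m),\dots,T_1(w_1),\dots,T_m(w_m))$ with the block of $m$ entries repeated $k$ times (cycle length $mk$). Sums are disjoint unions and $nH$ is $n$ disjoint copies of $H$. An edge-magic labeling of a graph with $p$ vertices and $q$ edges is a bijection $f:V\cup E\to\{1,\dots,p+q\}$ with $f(x)+f(xy)+f(y)$ constant over all edges; it is super edge-magic if also $f(V)=\{1,\dots,p\}$. -}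

module Defs where

open import Data.Nat using (ℕ; zero; suc; _+_; _<_)
open import Data.Fin using (Fin; zero; suc; toℕ; _↑ˡ_; _↑ʳ_)
open import Data.Fin.Subset using (Subset; ∁)
open import Data.Fin.Subset.Properties using (_∈?_)
open import Data.List using (List; []; _∷_; _++_; map; length; lookup; foldr; filter; concat; replicate; zip; allFin; [_])
open import Data.Product using (_×_; _,_; proj₁; proj₂)
open import Data.Sum using (_⊎_; inj₁; inj₂)
open import Function.Bundles using (_⤖_; Bijection)
open import Relation.Binary.PropositionalEquality using (_≡_)

-- Finite graphs: vertex set Fin order, edges a list of (unordered) pairs.
-- Edge e is position e in the list; pair orientation is irrelevant.

record Graph : Set where
  constructor graph
  field
    order : ℕ
    edges : List (Fin order × Fin order)

  size : ℕ
  size = length edges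

open Graph public

_⊕_ : Graph → Graph → Graph
graph p es ⊕ graph p' es' =
  graph (p + p')
        (map (λ e → (proj₁ e ↑ˡ p') , (proj₂ e ↑ˡ p')) es
         ++ map (λ e → (p ↑ʳ proj₁ e) , (p ↑ʳ proj₂ e)) es')

emptyGraph : Graph
emptyGraph = graph 0 []

⨁ : List Graph → Graph
⨁ = foldr _⊕_ emptyGraph

copies : ℕ → Graph → Graph
copies n H = ⨁ (replicate n H)

-- Trees with a distinguished vertex w, i.e. rooted trees T(w), as rose trees
-- (the root is the distinguished vertex w).

data Tree : Set where
  node : List Tree → Tree

mutual
  tsize : Tree → ℕ
  tsize (node ts) = suc (fsize ts)

  fsize : List Tree → ℕ
  fsize []       = 0
  fsize (t ∷ ts) = tsize t + fsize ts

troot : (t : Tree) → Fin (tsize t)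
troot (node ts) = zero

froots : (ts : List Tree) → List (Fin (fsize ts))
froots []       = []
froots (t ∷ ts) = (troot t ↑ˡ fsize ts) ∷ map (tsize t ↑ʳ_) (froots ts)

mutual
  tedges : (t : Tree) → List (Fin (tsize t) × Fin (tsize t))
  tedges (node ts) =
    map (λ r → zero , suc r) (froots ts)
    ++ map (λ e → suc (proj₁ e) , suc (proj₂ e)) (fedges ts)

  fedges : (ts : List Tree) → List (Fin (fsize ts) × Fin (fsize ts))
  fedges []       = []
  fedges (t ∷ ts) =
    map (λ e → (proj₁ e ↑ˡ fsize ts) , (proj₂ e ↑ˡ fsize ts)) (tedges t)
    ++ map (λ e → (tsize t ↑ʳ proj₁ e) , (tsize t ↑ʳ proj₂ e)) (fedges ts)

treeGraph : Tree → Graph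
treeGraph t = graph (tsize t) (tedges t)

cycleEdges : {A : Set} → List A → List (A × A)
cycleEdges []       = []
cycleEdges (a ∷ as) = zip (a ∷ as) (as ++ [ a ])

-- (T₁(w₁), …, T_m(w_m)) : cycle a₁⋯a_m with T_j attached by identifying w_j with a_j
unicyclic : List Tree → Graph
unicyclic ts = graph (fsize ts) (fedges ts ++ cycleEdges (froots ts))

-- H^k for H = (T₁(w₁),…,T_m(w_m)) : the block repeated k times
unicyclicPow : ℕ → List Tree → Graph
unicyclicPow k ts = unicyclic (concat (replicate k ts))

-- (Super) edge-magic labelings.  Labels are 1 + toℕ of the image in Fin (p+q),
-- so f is a bijection V ∪ E → {1,…,p+q}.

record EdgeMagicLabeling (G : Graph) : Set where
  field
    f     : (Fin (order G) ⊎ Fin (size G)) ⤖ Fin (order G + size G)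
    k     : ℕ
  label : Fin (order G) ⊎ Fin (size G) → ℕ
  label x = suc (toℕ (Bijection.to f x))
  field
    magic : ∀ (e : Fin (size G)) →
            label (inj₁ (proj₁ (lookup (edges G) e))) + label (inj₂ e)
              + label (inj₁ (proj₂ (lookup (edges G) e))) ≡ k

record SuperEdgeMagicLabeling (G : Graph) : Set where
  field
    eml   : EdgeMagicLabeling G
    super : ∀ (v : Fin (order G)) →
            toℕ (Bijection.to (EdgeMagicLabeling.f eml) (inj₁ v)) < order G

combined : (n l : ℕ) → (Fin l → List Tree) → Subset l → Graph
combined n l Ts J =
  ⨁ (map (λ j → copies n (unicyclic (Ts j))) (filter (_∈? J) (allFin l)))
  ⊕ ⨁ (map (λ i → unicyclicPow n (Ts i)) (filter (_∈? ∁ J) (allFin l)))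

sumGraph : (l : ℕ) → (Fin l → List Tree) → Graph
sumGraph l Ts = ⨁ (map (λ i → unicyclic (Ts i)) (allFin l))

module Submission where

-- Write n = 2s + 1.  Each component of the new graph is an n-fold cover of the corresponding G_i:
-- n disjoint copies, or the cyclic lift G_i^n, whose cycle closes only after n turns.  Suppose every
-- vertex and edge of the cover gets a fibre index in [0, n), injectively over each vertex and edge of
-- G_i, such that along every edge the indices of the edge and its two endpoints sum to 3s.  Then
-- relabelling x by n · (label of its image) + (fibre index) turns a (super) edge-magic labeling of G
-- into one of the cover.  The fibre index of vertex b · p + u (copy b of vertex u) is b · A + δ(u)
-- mod n for a potential δ that rises by s along tree edges and by s or s + 1 (≡ -s) along the cycle;
-- the sum of the two endpoint indices, x + (x + s) or x + (x + s + 1) mod n, is injective with values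
-- in [s, 3s].  The hypotheses on the cycle lengths are what lets δ close up around the cycle.

open import Defs
open import Data.Bool using (true; false; if_then_else_)
open import Data.Empty using (⊥; ⊥-elim)
open import Data.Fin as Fin using (Fin; toℕ; fromℕ<; _↑ˡ_; _↑ʳ_; splitAt; join; punchOut)
open import Data.Fin.Properties using (toℕ-injective; toℕ-fromℕ<; toℕ<n; toℕ-↑ˡ; toℕ-↑ʳ; join-splitAt; punchOut-injective; injective⇒≤) renaming (any? to any?ᶠ; _≟_ to _≟ᶠ_)
open import Data.Fin.Subset using (Subset; _∈_; ∁)
open import Data.Fin.Subset.Properties using (_∈?_; x∈∁p⇒x∉p; x∉p⇒x∈∁p)
open import Data.List using (List; []; _∷_; _++_; map; length; lookup; zip; zipWith; concat; replicate; [_]; filter; allFin)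
open import Data.List.Properties using (length-map; length-++; length-zipWith; map-++; map-cong; map-∘; map-id; map-zipWith; zipWith-map; ++-assoc; filter-accept; filter-reject)
open import Data.List.Relation.Unary.All as All using (All; []; _∷_)
open import Data.List.Relation.Unary.All.Properties using (++⁺; map⁺)
open import Data.Nat
open import Data.Nat.DivMod
open import Data.Nat.Properties
open import Data.Nat.Tactic.RingSolver using (solve-∀)
open import Data.Product using (_×_; _,_; proj₁; proj₂; ∃; uncurry)
open import Data.Sum using (_⊎_; inj₁; inj₂)
open import Data.Sum.Properties using (inj₁-injective; inj₂-injective)
open import Function using (_∘_)
open import Function.Bundles using (_⤖_; Bijection; mk⤖)
open import Function.Definitions using (Injective)
open import Relation.Binary.PropositionalEquality hiding ([_])
open import Relation.Nullary using (¬_; yes; no; does)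
open import Relation.Nullary.Decidable using (dec-true; dec-false)

[m*n+o]%n≡o : ∀ m n .{{_ : NonZero n}} {o} → o < n → (m * n + o) % n ≡ o
[m*n+o]%n≡o m n {o} o<n = begin
  (m * n + o) % n ≡⟨ cong (_% n) (+-comm (m * n) o) ⟩
  (o + m * n) % n ≡⟨ [m+kn]%n≡m%n o m n ⟩
  o % n           ≡⟨ m<n⇒m%n≡m o<n ⟩
  o               ∎
  where open ≡-Reasoning

[m*n+o]/n≡m : ∀ m n .{{_ : NonZero n}} {o} → o < n → (m * n + o) / n ≡ m
[m*n+o]/n≡m m n {o} o<n = begin
  (m * n + o) / n   ≡⟨ +-distrib-/ (m * n) o (subst (_< n) (sym (cong (_+ o % n) (m*n%n≡0 m n))) (m%n<n o n)) ⟩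
  m * n / n + o / n ≡⟨ cong₂ _+_ (m*n/n≡m m n) (m<n⇒m/n≡0 o<n) ⟩
  m + 0             ≡⟨ +-identityʳ m ⟩
  m                 ∎
  where open ≡-Reasoning

m≡[m/n]*n+m%n : ∀ m n .{{_ : NonZero n}} → m ≡ (m / n) * n + m % n
m≡[m/n]*n+m%n m n = trans (m≡m%n+[m/n]*n m n) (+-comm (m % n) _)

divMod-unique : ∀ {n} m m′ {o o′} → o < n → o′ < n → m * n + o ≡ m′ * n + o′ → m ≡ m′ × o ≡ o′
divMod-unique {suc n} m m′ {o} {o′} o<n o′<n eq =
  trans (sym ([m*n+o]/n≡m m (suc n) o<n)) (trans (cong (_/ suc n) eq) ([m*n+o]/n≡m m′ (suc n) o′<n)) ,
  trans (sym ([m*n+o]%n≡o m (suc n) o<n)) (trans (cong (_% suc n) eq) ([m*n+o]%n≡o m′ (suc n) o′<n))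

%≡%-by-multiple : ∀ n .{{_ : NonZero n}} {x y} a c → x ≡ a → y ≡ a + c * n → x % n ≡ y % n
%≡%-by-multiple n a c refl refl = sym ([m+kn]%n≡m%n a c n)

module _ (n : ℕ) .{{_ : NonZero n}} where

  %-cong-+ʳ : ∀ {a b} w → a % n ≡ b % n → (a + w) % n ≡ (b + w) % n
  %-cong-+ʳ {a} {b} w eq = begin
    (a + w) % n         ≡⟨ %-distribˡ-+ a w n ⟩
    (a % n + w % n) % n ≡⟨ cong (λ x → (x + w % n) % n) eq ⟩
    (b % n + w % n) % n ≡⟨ %-distribˡ-+ b w n ⟨
    (b + w) % n         ∎
    where open ≡-Reasoning

  %-cong-+ˡ : ∀ {a b} w → a % n ≡ b % n → (w + a) % n ≡ (w + b) % n
  %-cong-+ˡ {a} {b} w eq = begin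
    (w + a) % n ≡⟨ cong (_% n) (+-comm w a) ⟩
    (a + w) % n ≡⟨ %-cong-+ʳ w eq ⟩
    (b + w) % n ≡⟨ cong (_% n) (+-comm b w) ⟩
    (w + b) % n ∎
    where open ≡-Reasoning

  %-cong-*ʳ : ∀ {a b} w → a % n ≡ b % n → (a * w) % n ≡ (b * w) % n
  %-cong-*ʳ {a} {b} w eq = begin
    (a * w) % n           ≡⟨ %-distribˡ-* a w n ⟩
    (a % n * (w % n)) % n ≡⟨ cong (λ x → (x * (w % n)) % n) eq ⟩
    (b % n * (w % n)) % n ≡⟨ %-distribˡ-* b w n ⟨
    (b * w) % n           ∎
    where open ≡-Reasoning

  -- Adding the complement w of z modulo n turns z into a multiple of n.
  %-cancel-+ʳ : ∀ {a b} z → (a + z) % n ≡ (b + z) % n → a % n ≡ b % n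
  %-cancel-+ʳ {a} {b} z eq = begin
    a % n           ≡⟨ add-z+w a ⟨
    (a + z + w) % n ≡⟨ %-cong-+ʳ w eq ⟩
    (b + z + w) % n ≡⟨ add-z+w b ⟩
    b % n           ∎
    where
    open ≡-Reasoning
    w = n ∸ z % n
    z+w≡[1+z/n]*n : z + w ≡ suc (z / n) * n
    z+w≡[1+z/n]*n = begin
      z + w                   ≡⟨ cong (_+ w) (m≡m%n+[m/n]*n z n) ⟩
      z % n + (z / n) * n + w ≡⟨ ring (z % n) ((z / n) * n) w ⟩
      z % n + w + (z / n) * n ≡⟨ cong (_+ (z / n) * n) (m+[n∸m]≡n (<⇒≤ (m%n<n z n))) ⟩
      n + (z / n) * n         ∎
      where ring : ∀ a b c → a + b + c ≡ a + c + b
            ring = solve-∀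
    add-z+w : ∀ a → (a + z + w) % n ≡ a % n
    add-z+w a = trans (cong (_% n) (trans (+-assoc a z w) (cong (a +_) z+w≡[1+z/n]*n)))
                      ([m+kn]%n≡m%n a (suc (z / n)) n)

  %-injective-< : ∀ {a b} → a < n → b < n → a % n ≡ b % n → a ≡ b
  %-injective-< a<n b<n eq = trans (sym (m<n⇒m%n≡m a<n)) (trans eq (m<n⇒m%n≡m b<n))

m*n+o<k*n : ∀ {m k n o} → m < k → o < n → m * n + o < k * n
m*n+o<k*n {m} {k} {n} m<k o<n =
  ≤-trans (+-monoʳ-< (m * n) o<n) (subst (_≤ k * n) (+-comm n (m * n)) (*-monoˡ-≤ n m<k))

data EvenOdd (m : ℕ) : Set where
  even : ∀ h → m ≡ h + h → EvenOdd m
  odd  : ∀ h → m ≡ suc (h + h) → EvenOdd m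

evenOdd : ∀ m → EvenOdd m
evenOdd zero    = even 0 refl
evenOdd (suc m) with evenOdd m
... | even h refl = odd h refl
... | odd h refl  = even (suc h) (cong suc (sym (+-suc h h)))

[h+h]%2≡0 : ∀ h → (h + h) % 2 ≡ 0
[h+h]%2≡0 h = trans (cong (_% 2) (ring h)) ([m+kn]%n≡m%n 0 h 2)
  where ring : ∀ h → h + h ≡ 0 + h * 2
        ring = solve-∀

[1+h+h]%2≡1 : ∀ h → suc (h + h) % 2 ≡ 1
[1+h+h]%2≡1 h = trans (cong (_% 2) (ring h)) ([m+kn]%n≡m%n 1 h 2)
  where ring : ∀ h → suc (h + h) ≡ 1 + h * 2
        ring = solve-∀

m%2≡1⇒m≡1+h+h : ∀ {m} → m % 2 ≡ 1 → ∃ λ h → m ≡ suc (h + h)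
m%2≡1⇒m≡1+h+h {m} m%2≡1 with evenOdd m
... | even h refl = ⊥-elim (0≢1+n (trans (sym ([h+h]%2≡0 h)) m%2≡1))
... | odd h m≡    = h , m≡

m+m≤n+n⇒m≤n : ∀ {m n} → m + m ≤ n + n → m ≤ n
m+m≤n+n⇒m≤n {m} {n} m+m≤n+n with m ≤? n
... | yes m≤n = m≤n
... | no m≰n  = ⊥-elim (<⇒≱ (+-mono-< (≰⇒> m≰n) (≰⇒> m≰n)) m+m≤n+n)

-- Residues modulo n = 2s + 1

module OddModulus (s : ℕ) where

  n : ℕ
  n = suc (s + s)

  fibreSum : ℕ
  fibreSum = s + (s + s)

  twist : ℕ → ℕ → ℕ
  twist t x = x + (x + t) % n

  data HalfShift : ℕ → Set where
    half  : HalfShift s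
    half⁺ : HalfShift (suc s)

  untwist : ∀ {t} → HalfShift t → ℕ → ℕ → ℕ
  untwist half  zero    h = h
  untwist half  (suc _) h = suc s + h
  untwist half⁺ zero    h = s + h
  untwist half⁺ (suc _) h = h

  -- For t ∈ {s, s+1} the map x ↦ x + (x + t) mod n sends [0, n) to [s, 3s]: its value s + 2h + r
  -- (with r < 2) determines x through the bit r and h.
  record TwistForm {t} (ht : HalfShift t) (x : ℕ) : Set where
    field
      bit halves    : ℕ
      bit<2         : bit < 2
      twist≡        : twist t x ≡ s + (halves * 2 + bit)
      untwist≡      : x ≡ untwist ht bit halves
      halves-bound  : halves * 2 + bit ≤ s + s

  n+a%n≡a : ∀ {a} → a < n → (n + a) % n ≡ a
  n+a%n≡a {a} a<n = trans (cong (_% n) (+-comm n a)) (trans ([m+n]%n≡m%n a n) (m<n⇒m%n≡m a<n))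

  twistForm : ∀ {t} (ht : HalfShift t) x → x < n → TwistForm ht x
  twistForm half x x<n with x ≤? s
  ... | yes x≤s = record
    { bit = 0 ; halves = x ; bit<2 = s≤s z≤n ; untwist≡ = refl
    ; twist≡ = trans (cong (x +_) (m<n⇒m%n≡m (s≤s (+-monoˡ-≤ s x≤s)))) (ring x s)
    ; halves-bound = ≤-trans (≤-reflexive (ring′ x)) (+-mono-≤ x≤s x≤s) }
    where ring : ∀ x s → x + (x + s) ≡ s + (x * 2 + 0)
          ring = solve-∀
          ring′ : ∀ x → x * 2 + 0 ≡ x + x
          ring′ = solve-∀
  ... | no x≰s with m≤n⇒∃[o]m+o≡n (≰⇒> x≰s)
  ...   | a , refl = record
    { bit = 1 ; halves = a ; bit<2 = ≤-refl ; untwist≡ = refl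
    ; twist≡ = trans (cong (suc s + a +_) (trans (cong (_% n) (ring s a)) (n+a%n≡a (≤-trans a<s (≤-trans (m≤m+n s s) (n≤1+n _))))))
                     (ring′ s a)
    ; halves-bound = ≤-trans (≤-reflexive (ring″ a)) (≤-trans (+-monoˡ-≤ a a<s) (+-monoʳ-≤ s (<⇒≤ a<s))) }
    where a<s : a < s
          a<s = +-cancelˡ-≤ s (suc a) s (subst (_≤ s + s) (sym (+-suc s a)) (≤-pred x<n))
          ring : ∀ s a → suc s + a + s ≡ suc (s + s) + a
          ring = solve-∀
          ring′ : ∀ s a → suc s + a + a ≡ s + (a * 2 + 1)
          ring′ = solve-∀
          ring″ : ∀ a → a * 2 + 1 ≡ suc a + a
          ring″ = solve-∀
  twistForm half⁺ x x<n with x <? s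
  ... | yes x<s = record
    { bit = 1 ; halves = x ; bit<2 = ≤-refl ; untwist≡ = refl
    ; twist≡ = trans (cong (x +_) (m<n⇒m%n≡m (s≤s (subst (_≤ s + s) (sym (+-suc x s)) (+-monoˡ-≤ s x<s))))) (ring x s)
    ; halves-bound = ≤-trans (≤-reflexive (ring′ x)) (≤-trans (+-monoˡ-≤ x x<s) (+-monoʳ-≤ s (<⇒≤ x<s))) }
    where ring : ∀ x s → x + (x + suc s) ≡ s + (x * 2 + 1)
          ring = solve-∀
          ring′ : ∀ x → x * 2 + 1 ≡ suc x + x
          ring′ = solve-∀
  ... | no x≮s with m≤n⇒∃[o]m+o≡n (≮⇒≥ x≮s)
  ...   | a , refl = record
    { bit = 0 ; halves = a ; bit<2 = s≤s z≤n ; untwist≡ = refl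
    ; twist≡ = trans (cong (s + a +_) (trans (cong (_% n) (ring s a)) (n+a%n≡a (s≤s (≤-trans a≤s (m≤m+n s s))))))
                     (ring′ s a)
    ; halves-bound = ≤-trans (≤-reflexive (ring″ a)) (+-mono-≤ a≤s a≤s) }
    where a≤s : a ≤ s
          a≤s = +-cancelˡ-≤ s a s (≤-pred x<n)
          ring : ∀ s a → s + a + suc s ≡ suc (s + s) + a
          ring = solve-∀
          ring′ : ∀ s a → s + a + a ≡ s + (a * 2 + 0)
          ring′ = solve-∀
          ring″ : ∀ a → a * 2 + 0 ≡ a + a
          ring″ = solve-∀

  twist-injective : ∀ {t} → HalfShift t → ∀ {x y} → x < n → y < n → twist t x ≡ twist t y → x ≡ y
  twist-injective ht {x} {y} x<n y<n eq =
    trans (untwist≡ Fx) (trans (cong₂ (untwist ht) (proj₂ halves-bit≡) (proj₁ halves-bit≡)) (sym (untwist≡ Fy)))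
    where
    open TwistForm
    Fx = twistForm ht x x<n
    Fy = twistForm ht y y<n
    halves-bit≡ : halves Fx ≡ halves Fy × bit Fx ≡ bit Fy
    halves-bit≡ = divMod-unique (halves Fx) (halves Fy) (bit<2 Fx) (bit<2 Fy)
                    (+-cancelˡ-≡ s _ _ (trans (sym (twist≡ Fx)) (trans eq (twist≡ Fy))))

  s≤twist : ∀ {t} → HalfShift t → ∀ {x} → x < n → s ≤ twist t x
  s≤twist ht {x} x<n = subst (s ≤_) (sym (TwistForm.twist≡ (twistForm ht x x<n))) (m≤m+n s _)

  twist≤fibreSum : ∀ {t} → HalfShift t → ∀ {x} → x < n → twist t x ≤ fibreSum
  twist≤fibreSum ht {x} x<n =
    subst (_≤ fibreSum) (sym (TwistForm.twist≡ F)) (+-monoʳ-≤ s (TwistForm.halves-bound F))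
    where F = twistForm ht x x<n

  MulInjective : ℕ → Set
  MulInjective a = ∀ {b b′ c} → b < n → b′ < n → (b * a + c) % n ≡ (b′ * a + c) % n → b ≡ b′

  mulInjective-1 : MulInjective 1
  mulInjective-1 {b} {b′} {c} b<n b′<n eq = %-injective-< n {b} {b′} b<n b′<n (%-cancel-+ʳ n {b} {b′} c
    (subst₂ (λ u v → (u + c) % n ≡ (v + c) % n) (*-identityʳ b) (*-identityʳ b′) eq))

  -- 2s ≡ -1 (mod n), so twice b·s + c, plus b, is 2c modulo n.
  mulInjective-s : MulInjective s
  mulInjective-s {b} {b′} {c} b<n b′<n eq = %-injective-< n {b} {b′} b<n b′<n (%-cancel-+ʳ n {b} {b′} (y + y) (begin
    (b + (y + y)) % n  ≡⟨ cong (_% n) (+-comm b (y + y)) ⟩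
    (y + y + b) % n    ≡⟨ %-cong-+ʳ n {y + y} {x + x} b (sym 2x≡2y) ⟩
    (x + x + b) % n    ≡⟨ double-plus b ⟩
    (c + c) % n        ≡⟨ double-plus b′ ⟨
    (y + y + b′) % n   ≡⟨ cong (_% n) (+-comm (y + y) b′) ⟩
    (b′ + (y + y)) % n ∎))
    where
    open ≡-Reasoning
    x = b * s + c
    y = b′ * s + c
    double-plus : ∀ b → (b * s + c + (b * s + c) + b) % n ≡ (c + c) % n
    double-plus b = trans (cong (_% n) (ring b s c)) ([m+kn]%n≡m%n (c + c) b n)
      where ring : ∀ b s c → b * s + c + (b * s + c) + b ≡ c + c + b * suc (s + s)
            ring = solve-∀
    2x≡2y : (x + x) % n ≡ (y + y) % n
    2x≡2y = trans (%-distribˡ-+ x x n) (trans (cong₂ (λ u v → (u + v) % n) eq eq) (sym (%-distribˡ-+ y y n)))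

nth : {A : Set} → A → List A → ℕ → A
nth d []       _       = d
nth d (x ∷ xs) zero    = x
nth d (x ∷ xs) (suc i) = nth d xs i

module _ {A : Set} {d : A} where

  nth-++ˡ : ∀ xs ys {i} → i < length xs → nth d (xs ++ ys) i ≡ nth d xs i
  nth-++ˡ (x ∷ xs) ys {zero}  _         = refl
  nth-++ˡ (x ∷ xs) ys {suc i} (s≤s i<n) = nth-++ˡ xs ys i<n

  nth-++ʳ : ∀ xs ys i → nth d (xs ++ ys) (length xs + i) ≡ nth d ys i
  nth-++ʳ []       ys i = refl
  nth-++ʳ (x ∷ xs) ys i = nth-++ʳ xs ys i

  nth-map : ∀ {B : Set} {d′ : B} (f : A → B) xs {i} → i < length xs → nth d′ (map f xs) i ≡ f (nth d xs i)
  nth-map f (x ∷ xs) {zero}  _         = refl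
  nth-map f (x ∷ xs) {suc i} (s≤s i<n) = nth-map f xs i<n

All-nth : ∀ {A : Set} {P : A → Set} {d : A} {xs : List A} → All P xs → ∀ {i} → i < length xs → P (nth d xs i)
All-nth (px ∷ pxs) {zero}  _         = px
All-nth (px ∷ pxs) {suc i} (s≤s i<n) = All-nth pxs i<n

map-∘-cong : ∀ {A B C : Set} {f : B → C} {g : A → B} {h : A → C} → (∀ x → f (g x) ≡ h x) → ∀ xs → map f (map g xs) ≡ map h xs
map-∘-cong f∘g≗h xs = trans (sym (map-∘ xs)) (map-cong f∘g≗h xs)

-- Vertices are bare numbers here, so that disjoint unions and lifts become index arithmetic.

Edge : Set
Edge = ℕ × ℕ

_!_ : List Edge → ℕ → Edge
_!_ = nth (0 , 0)

_!ₙ_ : List ℕ → ℕ → ℕ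
_!ₙ_ = nth 0

mapEdge : {A B : Set} → (A → B) → A × A → B × B
mapEdge f (u , v) = f u , f v

shift : ℕ → Edge → Edge
shift k = mapEdge (k +_)

mapEdge-cong : ∀ {A B : Set} {f g : A → B} → (∀ w → f w ≡ g w) → ∀ x → mapEdge f x ≡ mapEdge g x
mapEdge-cong f≗g (u , v) = cong₂ _,_ (f≗g u) (f≗g v)

mapEdge-cong-< : ∀ {A : Set} {N} {f g : ℕ → A} → (∀ {w} → w < N → f w ≡ g w) → ∀ {x} → proj₁ x < N × proj₂ x < N → mapEdge f x ≡ mapEdge g x
mapEdge-cong-< f≗g (u<N , v<N) = cong₂ _,_ (f≗g u<N) (f≗g v<N)

record ℕGraph : Set where
  constructor ℕgraph
  field
    vcount : ℕ
    elist  : List Edge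
open ℕGraph public

ecount : ℕGraph → ℕ
ecount D = length (elist D)

_⊕ℕ_ : ℕGraph → ℕGraph → ℕGraph
D ⊕ℕ D′ = ℕgraph (vcount D + vcount D′) (elist D ++ map (shift (vcount D)) (elist D′))

map-shift-shift : ∀ a b es → map (shift a) (map (shift b) es) ≡ map (shift (a + b)) es
map-shift-shift a b = map-∘-cong (mapEdge-cong (λ w → sym (+-assoc a b w)))

ecount-⊕ℕ : ∀ D D′ → ecount (D ⊕ℕ D′) ≡ ecount D + ecount D′
ecount-⊕ℕ D D′ = trans (length-++ (elist D)) (cong (ecount D +_) (length-map _ (elist D′)))

WellFormed : ℕGraph → Set
WellFormed D = ∀ {e} → e < ecount D → proj₁ (elist D ! e) < vcount D × proj₂ (elist D ! e) < vcount D

toℕEdge : ∀ {m} → Fin m × Fin m → Edge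
toℕEdge = mapEdge toℕ

toℕGraph : Graph → ℕGraph
toℕGraph G = ℕgraph (order G) (map toℕEdge (edges G))

map-toℕEdge-! : ∀ {m} (xs : List (Fin m × Fin m)) (i : Fin (length xs)) → map toℕEdge xs ! toℕ i ≡ toℕEdge (lookup xs i)
map-toℕEdge-! (x ∷ xs) Fin.zero    = refl
map-toℕEdge-! (x ∷ xs) (Fin.suc i) = map-toℕEdge-! xs i

toℕGraph-ecount : ∀ G → ecount (toℕGraph G) ≡ size G
toℕGraph-ecount G = length-map toℕEdge (edges G)

toℕGraph-wellFormed : ∀ G → WellFormed (toℕGraph G)
toℕGraph-wellFormed G {e} e<q =
  subst (λ (u , v) → u < order G × v < order G) (sym eq) (toℕ<n _ , toℕ<n _)
  where
  e<q′ : e < size G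
  e<q′ = subst (e <_) (toℕGraph-ecount G) e<q
  eq : map toℕEdge (edges G) ! e ≡ toℕEdge (lookup (edges G) (fromℕ< e<q′))
  eq = trans (cong (map toℕEdge (edges G) !_) (sym (toℕ-fromℕ< e<q′))) (map-toℕEdge-! (edges G) (fromℕ< e<q′))

toℕGraph-⊕ : ∀ G G′ → toℕGraph (G ⊕ G′) ≡ toℕGraph G ⊕ℕ toℕGraph G′
toℕGraph-⊕ (graph p es) (graph p′ es′) = cong (ℕgraph (p + p′)) (begin
  map toℕEdge (map inl es ++ map inr es′)               ≡⟨ map-++ toℕEdge (map inl es) (map inr es′) ⟩
  map toℕEdge (map inl es) ++ map toℕEdge (map inr es′) ≡⟨ cong₂ _++_ left right ⟩
  map toℕEdge es ++ map (shift p) (map toℕEdge es′)     ∎)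
  where
  open ≡-Reasoning
  inl : Fin p × Fin p → Fin (p + p′) × Fin (p + p′)
  inl (u , v) = u ↑ˡ p′ , v ↑ˡ p′
  inr : Fin p′ × Fin p′ → Fin (p + p′) × Fin (p + p′)
  inr (u , v) = p ↑ʳ u , p ↑ʳ v
  left : map toℕEdge (map inl es) ≡ map toℕEdge es
  left = map-∘-cong (λ (u , v) → cong₂ _,_ (toℕ-↑ˡ u p′) (toℕ-↑ˡ v p′)) es
  right : map toℕEdge (map inr es′) ≡ map (shift p) (map toℕEdge es′)
  right = trans (map-∘-cong (λ (u , v) → cong₂ _,_ (toℕ-↑ʳ p u) (toℕ-↑ʳ p v)) es′) (map-∘ es′)

-- Covers and lifted labelings

-- Otherwise punching y out of the image would inject Fin (suc N) into Fin N.
Fin-injective⇒surjective : ∀ {N} (g : Fin N → Fin N) → Injective _≡_ _≡_ g → ∀ y → ∃ λ x → g x ≡ y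
Fin-injective⇒surjective g g-inj y with any?ᶠ (λ x → g x ≟ᶠ y)
... | yes hit = hit
Fin-injective⇒surjective {suc N} g g-inj y | no miss = ⊥-elim (<-irrefl refl (injective⇒≤ punched-inj))
  where
  punched : Fin (suc N) → Fin N
  punched x = punchOut {i = y} (λ y≡gx → miss (x , sym y≡gx))
  punched-inj : Injective _≡_ _≡_ punched
  punched-inj {a} {b} eq = g-inj (punchOut-injective (λ e → miss (a , sym e)) (λ e → miss (b , sym e)) eq)

module Covering (s : ℕ) where
  open OddModulus s

  record Cover (H G : ℕGraph) : Set where
    field
      vbase vfibre ebase efibre : ℕ → ℕ
      vbase<      : ∀ {w} → w < vcount H → vbase w < vcount G
      vfibre<     : ∀ {w} → w < vcount H → vfibre w < n
      ebase<      : ∀ {e} → e < ecount H → ebase e < ecount G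
      efibre<     : ∀ {e} → e < ecount H → efibre e < n
      v-injective : ∀ {w w′} → w < vcount H → w′ < vcount H → vbase w ≡ vbase w′ → vfibre w ≡ vfibre w′ → w ≡ w′
      e-injective : ∀ {e e′} → e < ecount H → e′ < ecount H → ebase e ≡ ebase e′ → efibre e ≡ efibre e′ → e ≡ e′
      vcount≡     : vcount H ≡ n * vcount G
      ecount≡     : ecount H ≡ n * ecount G
      edge-base   : ∀ {e} → e < ecount H → mapEdge vbase (elist H ! e) ≡ elist G ! ebase e
      fibre-sum   : ∀ {e} → e < ecount H → uncurry _+_ (mapEdge vfibre (elist H ! e)) + efibre e ≡ fibreSum

  liftedMagicConstant : ℕ → ℕ
  liftedMagicConstant k = (k ∸ 3) * n + (3 + fibreSum)

  lifted-magic-sum : ∀ a e b fa fe fb → fa + fb + fe ≡ fibreSum →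
    suc (a * n + fa) + suc (e * n + fe) + suc (b * n + fb) ≡ liftedMagicConstant (suc a + suc e + suc b)
  lifted-magic-sum a e b fa fe fb fibres = begin
    suc (a * n + fa) + suc (e * n + fe) + suc (b * n + fb) ≡⟨ ring a e b fa fe fb s ⟩
    (a + e + b) * n + (3 + (fa + fb + fe))                ≡⟨ cong₂ (λ x y → x * n + (3 + y)) (sym drop3) fibres ⟩
    (suc a + suc e + suc b ∸ 3) * n + (3 + fibreSum)       ∎
    where
    open ≡-Reasoning
    ring : ∀ a e b fa fe fb s → suc (a * suc (s + s) + fa) + suc (e * suc (s + s) + fe) + suc (b * suc (s + s) + fb)
                                ≡ (a + e + b) * suc (s + s) + (3 + (fa + fb + fe))
    ring = solve-∀
    drop3 : suc a + suc e + suc b ∸ 3 ≡ a + e + b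
    drop3 = trans (cong (_∸ 3) (ring′ a e b)) (m+n∸m≡n 3 (a + e + b))
      where ring′ : ∀ a e b → suc a + suc e + suc b ≡ 3 + (a + e + b)
            ring′ = solve-∀

  module Lift {H G : Graph} (cover : Cover (toℕGraph H) (toℕGraph G)) where
    open Cover cover

    private
      pH = order H
      qH = size H
      pG = order G
      qG = size G

    e<ecount : (e : Fin qH) → toℕ e < ecount (toℕGraph H)
    e<ecount e = subst (toℕ e <_) (sym (toℕGraph-ecount H)) (toℕ<n e)

    baseVertex : Fin pH → Fin pG
    baseVertex w = fromℕ< (vbase< (toℕ<n w))

    baseEdge : Fin qH → Fin qG
    baseEdge e = fromℕ< (subst (ebase (toℕ e) <_) (toℕGraph-ecount G) (ebase< (e<ecount e)))

    base : Fin pH ⊎ Fin qH → Fin pG ⊎ Fin qG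
    base (inj₁ w) = inj₁ (baseVertex w)
    base (inj₂ e) = inj₂ (baseEdge e)

    fibre : Fin pH ⊎ Fin qH → ℕ
    fibre (inj₁ w) = vfibre (toℕ w)
    fibre (inj₂ e) = efibre (toℕ e)

    fibre< : ∀ x → fibre x < n
    fibre< (inj₁ w) = vfibre< (toℕ<n w)
    fibre< (inj₂ e) = efibre< (e<ecount e)

    base-fibre-injective : ∀ {x y} → base x ≡ base y → fibre x ≡ fibre y → x ≡ y
    base-fibre-injective {inj₁ w} {inj₁ w′} b≡ f≡ = cong inj₁ (toℕ-injective
      (v-injective (toℕ<n w) (toℕ<n w′) (trans (sym (toℕ-fromℕ< _)) (trans (cong toℕ (inj₁-injective b≡)) (toℕ-fromℕ< _))) f≡))
    base-fibre-injective {inj₂ e} {inj₂ e′} b≡ f≡ = cong inj₂ (toℕ-injective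
      (e-injective (e<ecount e) (e<ecount e′) (trans (sym (toℕ-fromℕ< _)) (trans (cong toℕ (inj₂-injective b≡)) (toℕ-fromℕ< _))) f≡))

    total≡ : (pG + qG) * n ≡ pH + qH
    total≡ = trans (*-distribʳ-+ n pG qG) (cong₂ _+_ (trans (*-comm pG n) (sym vcount≡))
                   (trans (*-comm qG n) (trans (cong (n *_) (sym (toℕGraph-ecount G))) (trans (sym ecount≡) (toℕGraph-ecount H)))))

    module _ (f : (Fin pG ⊎ Fin qG) ⤖ Fin (pG + qG)) where

      label : Fin pG ⊎ Fin qG → ℕ
      label x = toℕ (Bijection.to f x)

      liftedLabel : Fin pH ⊎ Fin qH → ℕ
      liftedLabel x = label (base x) * n + fibre x

      liftedLabel< : ∀ x → liftedLabel x < pH + qH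
      liftedLabel< x = subst (liftedLabel x <_) total≡ (m*n+o<k*n {k = pG + qG} (toℕ<n (Bijection.to f (base x))) (fibre< x))

      liftedLabel-injective : ∀ {x y} → liftedLabel x ≡ liftedLabel y → x ≡ y
      liftedLabel-injective {x} {y} eq with divMod-unique (label (base x)) (label (base y)) (fibre< x) (fibre< y) eq
      ... | l≡ , f≡ = base-fibre-injective (Bijection.injective f (toℕ-injective l≡)) f≡

      liftedBijection : (Fin pH ⊎ Fin qH) ⤖ Fin (pH + qH)
      liftedBijection = mk⤖ (to-injective , to-surjective)
        where
        to : Fin pH ⊎ Fin qH → Fin (pH + qH)
        to x = fromℕ< (liftedLabel< x)
        to-injective : Injective _≡_ _≡_ to
        to-injective {x} {y} eq = liftedLabel-injective
          (trans (sym (toℕ-fromℕ< (liftedLabel< x))) (trans (cong toℕ eq) (toℕ-fromℕ< (liftedLabel< y))))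
        to-splitAt-injective : Injective _≡_ _≡_ (λ z → to (splitAt pH z))
        to-splitAt-injective {a} {b} eq =
          trans (sym (join-splitAt pH qH a)) (trans (cong (join pH qH) (to-injective eq)) (join-splitAt pH qH b))
        to-surjective : ∀ y → ∃ λ x → ∀ {z} → z ≡ x → to z ≡ y
        to-surjective y with Fin-injective⇒surjective (λ z → to (splitAt pH z)) to-splitAt-injective y
        ... | z , eq = splitAt pH z , λ { refl → eq }

    module _ (e : Fin qH) where
      private
        lookupH : elist (toℕGraph H) ! toℕ e ≡ toℕEdge (lookup (edges H) e)
        lookupH = map-toℕEdge-! (edges H) e
        lookupG : elist (toℕGraph G) ! ebase (toℕ e) ≡ toℕEdge (lookup (edges G) (baseEdge e))
        lookupG = trans (cong (elist (toℕGraph G) !_) (sym (toℕ-fromℕ< _))) (map-toℕEdge-! (edges G) (baseEdge e))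

      endpoints-over-baseEdge : baseVertex (proj₁ (lookup (edges H) e)) ≡ proj₁ (lookup (edges G) (baseEdge e))
                              × baseVertex (proj₂ (lookup (edges H) e)) ≡ proj₂ (lookup (edges G) (baseEdge e))
      endpoints-over-baseEdge =
        toℕ-injective (trans (toℕ-fromℕ< _) (cong proj₁ over)) , toℕ-injective (trans (toℕ-fromℕ< _) (cong proj₂ over))
        where over : mapEdge vbase (toℕEdge (lookup (edges H) e)) ≡ toℕEdge (lookup (edges G) (baseEdge e))
              over = trans (cong (mapEdge vbase) (sym lookupH)) (trans (edge-base (e<ecount e)) lookupG)

      edge-fibre-sum : fibre (inj₁ (proj₁ (lookup (edges H) e))) + fibre (inj₁ (proj₂ (lookup (edges H) e))) + fibre (inj₂ e) ≡ fibreSum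
      edge-fibre-sum = subst (λ x → uncurry _+_ (mapEdge vfibre x) + efibre (toℕ e) ≡ fibreSum) lookupH (fibre-sum (e<ecount e))

    liftEdgeMagic : EdgeMagicLabeling G → EdgeMagicLabeling H
    liftEdgeMagic L = record { f = liftedBijection f ; k = liftedMagicConstant k ; magic = lifted-magic }
      where
      open EdgeMagicLabeling L using (f; k; magic)
      lab : Fin pH ⊎ Fin qH → ℕ
      lab x = suc (toℕ (Bijection.to (liftedBijection f) x))
      lab≡ : ∀ x → lab x ≡ suc (label f (base x) * n + fibre x)
      lab≡ x = cong suc (toℕ-fromℕ< (liftedLabel< f x))
      lifted-magic : ∀ e → lab (inj₁ (proj₁ (lookup (edges H) e))) + lab (inj₂ e) + lab (inj₁ (proj₂ (lookup (edges H) e)))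
                           ≡ liftedMagicConstant k
      lifted-magic e = begin
        lab (inj₁ a) + lab (inj₂ e) + lab (inj₁ b)
          ≡⟨ cong₂ _+_ (cong₂ _+_ (lab≡ (inj₁ a)) (lab≡ (inj₂ e))) (lab≡ (inj₁ b)) ⟩
        suc (ℓ (inj₁ (baseVertex a)) * n + fa) + suc (ℓ (inj₂ e′) * n + fe) + suc (ℓ (inj₁ (baseVertex b)) * n + fb)
          ≡⟨ cong₂ (λ u v → suc (ℓ (inj₁ u) * n + fa) + suc (ℓ (inj₂ e′) * n + fe) + suc (ℓ (inj₁ v) * n + fb))
                   (proj₁ (endpoints-over-baseEdge e)) (proj₂ (endpoints-over-baseEdge e)) ⟩
        suc (ℓ (inj₁ u) * n + fa) + suc (ℓ (inj₂ e′) * n + fe) + suc (ℓ (inj₁ v) * n + fb)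
          ≡⟨ lifted-magic-sum (ℓ (inj₁ u)) (ℓ (inj₂ e′)) (ℓ (inj₁ v)) fa fe fb (edge-fibre-sum e) ⟩
        liftedMagicConstant (suc (ℓ (inj₁ u)) + suc (ℓ (inj₂ e′)) + suc (ℓ (inj₁ v)))
          ≡⟨ cong liftedMagicConstant (magic e′) ⟩
        liftedMagicConstant k ∎
        where
        open ≡-Reasoning
        ℓ = label f
        a = proj₁ (lookup (edges H) e)
        b = proj₂ (lookup (edges H) e)
        e′ = baseEdge e
        u = proj₁ (lookup (edges G) e′)
        v = proj₂ (lookup (edges G) e′)
        fa = fibre (inj₁ a)
        fb = fibre (inj₁ b)
        fe = fibre (inj₂ e)

    liftSuperEdgeMagic : SuperEdgeMagicLabeling G → SuperEdgeMagicLabeling H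
    liftSuperEdgeMagic L = record { eml = liftEdgeMagic eml ; super = lifted-super }
      where
      open SuperEdgeMagicLabeling L using (eml; super)
      f = EdgeMagicLabeling.f eml
      lifted-super : ∀ w → toℕ (Bijection.to (liftedBijection f) (inj₁ w)) < pH
      lifted-super w = subst (_< pH) (sym (toℕ-fromℕ< (liftedLabel< f (inj₁ w))))
        (subst (liftedLabel f (inj₁ w) <_) (trans (*-comm pG n) (sym vcount≡)) (m*n+o<k*n {k = pG} (super (baseVertex w)) (fibre< (inj₁ w))))

-- Covers of disjoint unions

joinAt : ℕ → (ℕ → ℕ) → (ℕ → ℕ) → ℕ → ℕ
joinAt q f g w = if does (w <? q) then f w else g (w ∸ q)

module _ {q : ℕ} {f g : ℕ → ℕ} where

  joinAt-< : ∀ {w} → w < q → joinAt q f g w ≡ f w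
  joinAt-< {w} w<q rewrite dec-true (w <? q) w<q = refl

  joinAt-+ : ∀ w → joinAt q f g (q + w) ≡ g w
  joinAt-+ w rewrite dec-false (q + w <? q) (≤⇒≯ (m≤m+n q w)) | m+n∸m≡n q w = refl

splice : ℕ → ℕ → (ℕ → ℕ) → (ℕ → ℕ) → ℕ → ℕ
splice a b outer inner = joinAt a outer (joinAt b inner (λ u → outer (a + u)))

module _ {a b : ℕ} {outer inner : ℕ → ℕ} where

  private
    rest : ℕ → ℕ
    rest = joinAt b inner (λ u → outer (a + u))

  splice-left : ∀ {w} → w < a → splice a b outer inner w ≡ outer w
  splice-left = joinAt-< {a} {outer} {rest}

  splice-middle : ∀ {w} → w < b → splice a b outer inner (a + w) ≡ inner w
  splice-middle {w} w<b = trans (joinAt-+ {a} {outer} {rest} w) (joinAt-< {b} {inner} {λ u → outer (a + u)} w<b)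

  splice-right : ∀ w → splice a b outer inner (a + b + w) ≡ outer (a + w)
  splice-right w = trans (cong (splice a b outer inner) (+-assoc a b w))
                         (trans (joinAt-+ {a} {outer} {rest} (b + w)) (joinAt-+ {b} {inner} {λ u → outer (a + u)} w))

data Region (a b c w : ℕ) : Set where
  left   : w < a → Region a b c w
  middle : ∀ w′ → w′ < b → w ≡ a + w′ → Region a b c w
  right  : ∀ w′ → w′ < c → w ≡ a + b + w′ → Region a b c w

region : ∀ a b c {w} → w < a + (b + c) → Region a b c w
region a b c {w} w< with w <? a
... | yes w<a = left w<a
... | no w≮a with m≤n⇒∃[o]m+o≡n (≮⇒≥ w≮a)
...   | w′ , refl with w′ <? b
...     | yes w′<b = middle w′ w′<b refl
...     | no w′≮b with m≤n⇒∃[o]m+o≡n (≮⇒≥ w′≮b)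
...       | w″ , refl = right w″ (+-cancelˡ-< (a + b) w″ c (subst₂ _<_ (sym (+-assoc a b w″)) (sym (+-assoc a b c)) w<))
                              (sym (+-assoc a b w″))

data Side (a b w : ℕ) : Set where
  first  : w < a → Side a b w
  second : ∀ w′ → w′ < b → w ≡ a + w′ → Side a b w

side : ∀ a b {w} → w < a + b → Side a b w
side a b {w} w< with w <? a
... | yes w<a = first w<a
... | no w≮a with m≤n⇒∃[o]m+o≡n (≮⇒≥ w≮a)
...   | w′ , refl = second w′ (+-cancelˡ-< a w′ b w<) refl

-- The offset K keeps the spliced outer f-values above the inner ones.
module SplicePair (a b c K : ℕ) (f g f′ g′ : ℕ → ℕ)
  (outer-injective : ∀ {u u′} → u < a + c → u′ < a + c → f u ≡ f u′ → g u ≡ g u′ → u ≡ u′)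
  (inner-injective : ∀ {u u′} → u < b → u′ < b → f′ u ≡ f′ u′ → g′ u ≡ g′ u′ → u ≡ u′)
  (f′<K : ∀ {u} → u < b → f′ u < K) where

  F G : ℕ → ℕ
  F = splice a b (λ w → K + f w) f′
  G = splice a b g g′

  F-left : ∀ {w} → w < a → F w ≡ K + f w
  F-left = splice-left {a} {b} {λ w → K + f w} {f′}
  F-middle : ∀ {w} → w < b → F (a + w) ≡ f′ w
  F-middle = splice-middle {a} {b} {λ w → K + f w} {f′}
  F-right : ∀ w → F (a + b + w) ≡ K + f (a + w)
  F-right = splice-right {a} {b} {λ w → K + f w} {f′}
  G-left : ∀ {w} → w < a → G w ≡ g w
  G-left = splice-left {a} {b} {g} {g′}
  G-middle : ∀ {w} → w < b → G (a + w) ≡ g′ w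
  G-middle = splice-middle {a} {b} {g} {g′}
  G-right : ∀ w → G (a + b + w) ≡ g (a + w)
  G-right = splice-right {a} {b} {g} {g′}

  private
    separated : ∀ {w u} → w < a + c → u < b → K + f w ≢ f′ u
    separated _ u<b eq = <⇒≱ (f′<K u<b) (subst (K ≤_) eq (m≤m+n K _))

    K+-injective : ∀ {u u′} → u < a + c → u′ < a + c → K + f u ≡ K + f u′ → g u ≡ g u′ → u ≡ u′
    K+-injective u< u′< eq = outer-injective u< u′< (+-cancelˡ-≡ K _ _ eq)

    left<a+c : ∀ {w} → w < a → w < a + c
    left<a+c w<a = ≤-trans w<a (m≤m+n _ c)

    right<a+c : ∀ {u} → u < c → a + u < a + c
    right<a+c = +-monoʳ-< a

    regions-injective : ∀ {w w′} → Region a b c w → Region a b c w′ → F w ≡ F w′ → G w ≡ G w′ → w ≡ w′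
    regions-injective (left p) (left p′) F≡ G≡ = K+-injective (left<a+c p) (left<a+c p′)
      (trans (sym (F-left p)) (trans F≡ (F-left p′))) (trans (sym (G-left p)) (trans G≡ (G-left p′)))
    regions-injective (left p) (middle u q refl) F≡ _ =
      ⊥-elim (separated (left<a+c p) q (trans (sym (F-left p)) (trans F≡ (F-middle q))))
    regions-injective (middle u q refl) (left p) F≡ _ =
      ⊥-elim (separated (left<a+c p) q (trans (sym (F-left p)) (trans (sym F≡) (F-middle q))))
    regions-injective {w} (left p) (right u q refl) F≡ G≡ = ⊥-elim (<⇒≱ p (subst (a ≤_) (sym w≡a+u) (m≤m+n a u)))
      where w≡a+u = K+-injective (left<a+c p) (right<a+c q)
              (trans (sym (F-left p)) (trans F≡ (F-right u))) (trans (sym (G-left p)) (trans G≡ (G-right u)))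
    regions-injective {w′ = w′} (right u q refl) (left p) F≡ G≡ = ⊥-elim (<⇒≱ p (subst (a ≤_) (sym w′≡a+u) (m≤m+n a u)))
      where w′≡a+u = K+-injective (left<a+c p) (right<a+c q)
              (trans (sym (F-left p)) (trans (sym F≡) (F-right u))) (trans (sym (G-left p)) (trans (sym G≡) (G-right u)))
    regions-injective (middle u q refl) (middle u′ q′ refl) F≡ G≡ = cong (a +_) (inner-injective q q′
      (trans (sym (F-middle q)) (trans F≡ (F-middle q′))) (trans (sym (G-middle q)) (trans G≡ (G-middle q′))))
    regions-injective (middle u q refl) (right u′ q′ refl) F≡ _ =
      ⊥-elim (separated (right<a+c q′) q (trans (sym (F-right u′)) (trans (sym F≡) (F-middle q))))
    regions-injective (right u q refl) (middle u′ q′ refl) F≡ _ =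
      ⊥-elim (separated (right<a+c q) q′ (trans (sym (F-right u)) (trans F≡ (F-middle q′))))
    regions-injective (right u q refl) (right u′ q′ refl) F≡ G≡ = cong (a + b +_) (+-cancelˡ-≡ a _ _
      (K+-injective (right<a+c q) (right<a+c q′)
        (trans (sym (F-right u)) (trans F≡ (F-right u′))) (trans (sym (G-right u)) (trans G≡ (G-right u′)))))

  splice-injective : ∀ {w w′} → w < a + (b + c) → w′ < a + (b + c) → F w ≡ F w′ → G w ≡ G w′ → w ≡ w′
  splice-injective w< w′< = regions-injective (region a b c w<) (region a b c w′<)

spliced-count : ∀ n x b y g s → x + y ≡ n * s → b ≡ n * g → x + (b + y) ≡ n * (g + s)
spliced-count n x b y g s x+y≡ b≡ = begin
  x + (b + y)         ≡⟨ ring x b y ⟩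
  b + (x + y)         ≡⟨ cong₂ _+_ b≡ x+y≡ ⟩
  n * g + n * s       ≡⟨ *-distribˡ-+ n g s ⟨
  n * (g + s)         ∎
  where open ≡-Reasoning
        ring : ∀ x b y → x + (b + y) ≡ b + (x + y)
        ring = solve-∀

module CoverSplice (s : ℕ) {X Y B S G₀ : ℕGraph} (X-wf : WellFormed X) (B-wf : WellFormed B) where
  open OddModulus s
  open Covering s

  module _ (cXY : Cover (X ⊕ℕ Y) S) (cB : Cover B G₀) where
    private
      module XY = Cover cXY
      module BG = Cover cB
      oX = vcount X
      oY = vcount Y
      oB = vcount B
      oS = vcount S
      oG₀ = vcount G₀
      lX = ecount X
      lY = ecount Y
      lB = ecount B
      lS = ecount S
      lG₀ = ecount G₀
      H = X ⊕ℕ (B ⊕ℕ Y)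
      G = G₀ ⊕ℕ S
      EXY = elist (X ⊕ℕ Y)

      lXY : ecount (X ⊕ℕ Y) ≡ lX + lY
      lXY = ecount-⊕ℕ X Y
      lBY : ecount (B ⊕ℕ Y) ≡ lB + lY
      lBY = ecount-⊕ℕ B Y
      lH : ecount H ≡ lX + (lB + lY)
      lH = trans (ecount-⊕ℕ X (B ⊕ℕ Y)) (cong (lX +_) lBY)
      lG : ecount G ≡ lG₀ + lS
      lG = ecount-⊕ℕ G₀ S

      module V = SplicePair oX oB oY oG₀ XY.vbase XY.vfibre BG.vbase BG.vfibre XY.v-injective BG.v-injective BG.vbase<
      module E = SplicePair lX lB lY lG₀ XY.ebase XY.efibre BG.ebase BG.efibre
                   (λ p p′ → XY.e-injective (subst (_ <_) (sym lXY) p) (subst (_ <_) (sym lXY) p′)) BG.e-injective BG.ebase<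

      G-left : ∀ {j} → j < lG₀ → elist G ! j ≡ elist G₀ ! j
      G-left = nth-++ˡ (elist G₀) _

      G-right : ∀ {j} → j < lS → elist G ! (lG₀ + j) ≡ shift oG₀ (elist S ! j)
      G-right {j} j< = trans (nth-++ʳ (elist G₀) _ j) (nth-map (shift oG₀) (elist S) j<)

      data EdgeOrigin (e : ℕ) : Set where
        inXY : ∀ j → j < ecount (X ⊕ℕ Y) → E.F e ≡ lG₀ + XY.ebase j → E.G e ≡ XY.efibre j →
               mapEdge V.F (elist H ! e) ≡ mapEdge ((oG₀ +_) ∘ XY.vbase) (EXY ! j) →
               mapEdge V.G (elist H ! e) ≡ mapEdge XY.vfibre (EXY ! j) → EdgeOrigin e
        inB  : ∀ j → j < lB → E.F e ≡ BG.ebase j → E.G e ≡ BG.efibre j →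
               mapEdge V.F (elist H ! e) ≡ mapEdge BG.vbase (elist B ! j) →
               mapEdge V.G (elist H ! e) ≡ mapEdge BG.vfibre (elist B ! j) → EdgeOrigin e

      edgeOrigin : ∀ {e} → e < ecount H → EdgeOrigin e
      edgeOrigin {e} e< with region lX lB lY (subst (e <_) lH e<)
      ... | left q = inXY e (subst (e <_) (sym lXY) (≤-trans q (m≤m+n lX lY))) (E.F-left q) (E.G-left q)
              (trans (cong (mapEdge V.F) H≡) (trans (mapEdge-cong-< {f = V.F} V.F-left (X-wf q)) (cong (mapEdge ((oG₀ +_) ∘ XY.vbase)) (sym XY≡))))
              (trans (cong (mapEdge V.G) H≡) (trans (mapEdge-cong-< {f = V.G} V.G-left (X-wf q)) (cong (mapEdge XY.vfibre) (sym XY≡))))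
        where
        H≡ : elist H ! e ≡ elist X ! e
        H≡ = nth-++ˡ (elist X) _ q
        XY≡ : EXY ! e ≡ elist X ! e
        XY≡ = nth-++ˡ (elist X) _ q
      ... | middle u q refl = inB u q (E.F-middle q) (E.G-middle q)
              (trans (cong (mapEdge V.F) H≡) (mapEdge-cong-< {f = λ w → V.F (oX + w)} V.F-middle (B-wf q)))
              (trans (cong (mapEdge V.G) H≡) (mapEdge-cong-< {f = λ w → V.G (oX + w)} V.G-middle (B-wf q)))
        where
        H≡ : elist H ! (lX + u) ≡ shift oX (elist B ! u)
        H≡ = trans (nth-++ʳ (elist X) _ u) (trans (nth-map (shift oX) (elist (B ⊕ℕ Y)) (subst (u <_) (sym lBY) (≤-trans q (m≤m+n lB lY))))
                   (cong (shift oX) (nth-++ˡ (elist B) _ q)))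
      ... | right u q refl = inXY (lX + u) (subst (lX + u <_) (sym lXY) (+-monoʳ-< lX q)) (E.F-right u) (E.G-right u)
              (trans (cong (mapEdge V.F) H≡) (trans (mapEdge-cong {f = λ w → V.F (oX + (oB + w))} (λ w → trans (cong V.F (sym (+-assoc oX oB w))) (V.F-right w)) (elist Y ! u))
                     (cong (mapEdge ((oG₀ +_) ∘ XY.vbase)) (sym XY≡))))
              (trans (cong (mapEdge V.G) H≡) (trans (mapEdge-cong {f = λ w → V.G (oX + (oB + w))} (λ w → trans (cong V.G (sym (+-assoc oX oB w))) (V.G-right w)) (elist Y ! u))
                     (cong (mapEdge XY.vfibre) (sym XY≡))))
        where
        H≡ : elist H ! (lX + lB + u) ≡ shift oX (shift oB (elist Y ! u))
        H≡ = trans (cong (elist H !_) (+-assoc lX lB u)) (trans (nth-++ʳ (elist X) _ (lB + u))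
               (trans (nth-map (shift oX) (elist (B ⊕ℕ Y)) (subst (lB + u <_) (sym lBY) (+-monoʳ-< lB q)))
                 (cong (shift oX) (trans (nth-++ʳ {d = 0 , 0} (elist B) _ u) (nth-map (shift oB) (elist Y) q)))))
        XY≡ : EXY ! (lX + u) ≡ shift oX (elist Y ! u)
        XY≡ = trans (nth-++ʳ (elist X) _ u) (nth-map (shift oX) (elist Y) q)

      edge-base : ∀ {e} → e < ecount H → mapEdge V.F (elist H ! e) ≡ elist G ! E.F e
      edge-base {e} e< with edgeOrigin e<
      ... | inXY j j< F≡ _ F-edge _ = begin
        mapEdge V.F (elist H ! e)               ≡⟨ F-edge ⟩
        shift oG₀ (mapEdge XY.vbase (EXY ! j))  ≡⟨ cong (shift oG₀) (XY.edge-base j<) ⟩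
        shift oG₀ (elist S ! XY.ebase j)        ≡⟨ G-right (XY.ebase< j<) ⟨
        elist G ! (lG₀ + XY.ebase j)            ≡⟨ cong (elist G !_) F≡ ⟨
        elist G ! E.F e                         ∎
        where open ≡-Reasoning
      ... | inB j j< F≡ _ F-edge _ = begin
        mapEdge V.F (elist H ! e)        ≡⟨ F-edge ⟩
        mapEdge BG.vbase (elist B ! j)   ≡⟨ BG.edge-base j< ⟩
        elist G₀ ! BG.ebase j            ≡⟨ G-left (BG.ebase< j<) ⟨
        elist G ! BG.ebase j             ≡⟨ cong (elist G !_) F≡ ⟨
        elist G ! E.F e                  ∎
        where open ≡-Reasoning

      fibre-sum : ∀ {e} → e < ecount H → uncurry _+_ (mapEdge V.G (elist H ! e)) + E.G e ≡ fibreSum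
      fibre-sum e< with edgeOrigin e<
      ... | inXY j j< _ G≡ _ G-edge = trans (cong₂ _+_ (cong (uncurry _+_) G-edge) G≡) (XY.fibre-sum j<)
      ... | inB j j< _ G≡ _ G-edge = trans (cong₂ _+_ (cong (uncurry _+_) G-edge) G≡) (BG.fibre-sum j<)

      vbase< : ∀ {w} → w < vcount H → V.F w < vcount G
      vbase< w< with region oX oB oY w<
      ... | left q rewrite V.F-left q = +-monoʳ-< oG₀ (XY.vbase< (≤-trans q (m≤m+n oX oY)))
      ... | middle u q refl rewrite V.F-middle q = ≤-trans (BG.vbase< q) (m≤m+n oG₀ oS)
      ... | right u q refl rewrite V.F-right u = +-monoʳ-< oG₀ (XY.vbase< (+-monoʳ-< oX q))

      vfibre< : ∀ {w} → w < vcount H → V.G w < n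
      vfibre< w< with region oX oB oY w<
      ... | left q rewrite V.G-left q = XY.vfibre< (≤-trans q (m≤m+n oX oY))
      ... | middle u q refl rewrite V.G-middle q = BG.vfibre< q
      ... | right u q refl rewrite V.G-right u = XY.vfibre< (+-monoʳ-< oX q)

      ebase< : ∀ {e} → e < ecount H → E.F e < ecount G
      ebase< e< with edgeOrigin e<
      ... | inXY j j< F≡ _ _ _ rewrite F≡ | lG = +-monoʳ-< lG₀ (XY.ebase< j<)
      ... | inB j j< F≡ _ _ _ rewrite F≡ | lG = ≤-trans (BG.ebase< j<) (m≤m+n lG₀ lS)

      efibre< : ∀ {e} → e < ecount H → E.G e < n
      efibre< e< with edgeOrigin e<
      ... | inXY j j< _ G≡ _ _ rewrite G≡ = XY.efibre< j<
      ... | inB j j< _ G≡ _ _ rewrite G≡ = BG.efibre< j<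

    spliceCover : Cover (X ⊕ℕ (B ⊕ℕ Y)) (G₀ ⊕ℕ S)
    spliceCover = record
      { vbase = V.F ; vfibre = V.G ; ebase = E.F ; efibre = E.G
      ; vbase< = vbase< ; vfibre< = vfibre< ; ebase< = ebase< ; efibre< = efibre<
      ; v-injective = V.splice-injective
      ; e-injective = λ p p′ → E.splice-injective (subst (_ <_) lH p) (subst (_ <_) lH p′)
      ; vcount≡ = spliced-count n oX oB oY oG₀ oS XY.vcount≡ BG.vcount≡
      ; ecount≡ = trans lH (trans (spliced-count n lX lB lY lG₀ lS (trans (sym lXY) XY.ecount≡) BG.ecount≡) (cong (n *_) (sym lG)))
      ; edge-base = edge-base ; fibre-sum = fibre-sum }

∅ℕ : ℕGraph
∅ℕ = ℕgraph 0 []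

∅ℕ-⊕ℕ : ∀ D → ∅ℕ ⊕ℕ D ≡ D
∅ℕ-⊕ℕ (ℕgraph v es) = cong (ℕgraph v) (map-id es)

⊕ℕ-assoc : ∀ P Q R → (P ⊕ℕ Q) ⊕ℕ R ≡ P ⊕ℕ (Q ⊕ℕ R)
⊕ℕ-assoc (ℕgraph a EP) (ℕgraph b EQ) (ℕgraph c ER) = cong₂ ℕgraph (+-assoc a b c) (begin
  (EP ++ map (shift a) EQ) ++ map (shift (a + b)) ER           ≡⟨ ++-assoc EP _ _ ⟩
  EP ++ (map (shift a) EQ ++ map (shift (a + b)) ER)           ≡⟨ cong (λ es → EP ++ (map (shift a) EQ ++ es)) (map-shift-shift a b ER) ⟨
  EP ++ (map (shift a) EQ ++ map (shift a) (map (shift b) ER)) ≡⟨ cong (EP ++_) (map-++ (shift a) EQ _) ⟨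
  EP ++ map (shift a) (EQ ++ map (shift b) ER)                 ∎)
  where open ≡-Reasoning

module CoverSum (s : ℕ) {l : ℕ} (J : Subset l) (G H H′ : Fin l → Graph) where
  open OddModulus s
  open Covering s

  emptyCover : Cover ∅ℕ ∅ℕ
  emptyCover = record
    { vbase = λ _ → 0 ; vfibre = λ _ → 0 ; ebase = λ _ → 0 ; efibre = λ _ → 0
    ; vbase< = λ () ; vfibre< = λ () ; ebase< = λ () ; efibre< = λ ()
    ; v-injective = λ () ; e-injective = λ ()
    ; vcount≡ = sym (*-zeroʳ n) ; ecount≡ = sym (*-zeroʳ n)
    ; edge-base = λ () ; fibre-sum = λ () }

  ⨁G ⨁H ⨁H′ : List (Fin l) → Graph
  ⨁G  xs = ⨁ (map G xs)
  ⨁H  xs = ⨁ (map H (filter (_∈? J) xs))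
  ⨁H′ xs = ⨁ (map H′ (filter (_∈? ∁ J) xs))

  module _ (cover : ∀ i → i ∈ J → Cover (toℕGraph (H i)) (toℕGraph (G i)))
           (cover′ : ∀ i → i ∈ ∁ J → Cover (toℕGraph (H′ i)) (toℕGraph (G i))) where

    sumCover : ∀ xs → Cover (toℕGraph (⨁H xs ⊕ ⨁H′ xs)) (toℕGraph (⨁G xs))
    sumCover [] = emptyCover
    sumCover (i ∷ xs) with i ∈? J
    ... | yes i∈J rewrite filter-reject (_∈? ∁ J) {xs = xs} (λ i∈∁J → x∈∁p⇒x∉p i∈∁J i∈J) =
      subst₂ Cover H≡ (sym (toℕGraph-⊕ (G i) (⨁G xs)))
        (CoverSplice.spliceCover s {X = ∅ℕ} (λ ()) (toℕGraph-wellFormed (H i)) rest (cover i i∈J))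
      where
      Rest = toℕGraph (⨁H xs) ⊕ℕ toℕGraph (⨁H′ xs)
      rest : Cover (∅ℕ ⊕ℕ Rest) (toℕGraph (⨁G xs))
      rest = subst (λ D → Cover D (toℕGraph (⨁G xs))) (trans (toℕGraph-⊕ (⨁H xs) (⨁H′ xs)) (sym (∅ℕ-⊕ℕ Rest))) (sumCover xs)
      H≡ : ∅ℕ ⊕ℕ (toℕGraph (H i) ⊕ℕ Rest) ≡ toℕGraph ((H i ⊕ ⨁H xs) ⊕ ⨁H′ xs)
      H≡ = begin
        ∅ℕ ⊕ℕ (toℕGraph (H i) ⊕ℕ Rest)                               ≡⟨ ∅ℕ-⊕ℕ _ ⟩
        toℕGraph (H i) ⊕ℕ Rest                                        ≡⟨ ⊕ℕ-assoc (toℕGraph (H i)) _ _ ⟨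
        (toℕGraph (H i) ⊕ℕ toℕGraph (⨁H xs)) ⊕ℕ toℕGraph (⨁H′ xs)    ≡⟨ cong (_⊕ℕ toℕGraph (⨁H′ xs)) (toℕGraph-⊕ (H i) (⨁H xs)) ⟨
        toℕGraph (H i ⊕ ⨁H xs) ⊕ℕ toℕGraph (⨁H′ xs)                  ≡⟨ toℕGraph-⊕ (H i ⊕ ⨁H xs) (⨁H′ xs) ⟨
        toℕGraph ((H i ⊕ ⨁H xs) ⊕ ⨁H′ xs)                            ∎
        where open ≡-Reasoning
    ... | no i∉J rewrite filter-accept (_∈? ∁ J) {xs = xs} (x∉p⇒x∈∁p i∉J) =
      subst₂ Cover H≡ (sym (toℕGraph-⊕ (G i) (⨁G xs)))
        (CoverSplice.spliceCover s (toℕGraph-wellFormed (⨁H xs)) (toℕGraph-wellFormed (H′ i)) rest (cover′ i (x∉p⇒x∈∁p i∉J)))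
      where
      rest : Cover (toℕGraph (⨁H xs) ⊕ℕ toℕGraph (⨁H′ xs)) (toℕGraph (⨁G xs))
      rest = subst (λ D → Cover D (toℕGraph (⨁G xs))) (toℕGraph-⊕ (⨁H xs) (⨁H′ xs)) (sumCover xs)
      H≡ : toℕGraph (⨁H xs) ⊕ℕ (toℕGraph (H′ i) ⊕ℕ toℕGraph (⨁H′ xs)) ≡ toℕGraph (⨁H xs ⊕ (H′ i ⊕ ⨁H′ xs))
      H≡ = trans (cong (toℕGraph (⨁H xs) ⊕ℕ_) (sym (toℕGraph-⊕ (H′ i) (⨁H′ xs)))) (sym (toℕGraph-⊕ (⨁H xs) (H′ i ⊕ ⨁H′ xs)))

treeEdgesℕ : Tree → List Edge
treeEdgesℕ t = map toℕEdge (tedges t)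

forestEdgesℕ : List Tree → List Edge
forestEdgesℕ ts = map toℕEdge (fedges ts)

rootsℕ : List Tree → List ℕ
rootsℕ ts = map toℕ (froots ts)

forestEdgesℕ-∷ : ∀ t ts → forestEdgesℕ (t ∷ ts) ≡ treeEdgesℕ t ++ map (shift (tsize t)) (forestEdgesℕ ts)
forestEdgesℕ-∷ t ts = trans (map-++ toℕEdge (map _ (tedges t)) (map _ (fedges ts))) (cong₂ _++_
  (map-∘-cong (λ (u , v) → cong₂ _,_ (toℕ-↑ˡ u (fsize ts)) (toℕ-↑ˡ v (fsize ts))) (tedges t))
  (trans (map-∘-cong {h = shift (tsize t) ∘ toℕEdge} (λ (u , v) → cong₂ _,_ (toℕ-↑ʳ (tsize t) u) (toℕ-↑ʳ (tsize t) v)) (fedges ts))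
         (map-∘ (fedges ts))))

rootsℕ-∷ : ∀ cs ts → rootsℕ (node cs ∷ ts) ≡ 0 ∷ map (tsize (node cs) +_) (rootsℕ ts)
rootsℕ-∷ cs ts = cong (0 ∷_) (trans (map-∘-cong {h = (suc (fsize cs) +_) ∘ toℕ} (toℕ-↑ʳ (suc (fsize cs))) (froots ts)) (map-∘ (froots ts)))

treeEdgesℕ-node : ∀ cs → treeEdgesℕ (node cs) ≡ map (λ r → 0 , suc r) (rootsℕ cs) ++ map (shift 1) (forestEdgesℕ cs)
treeEdgesℕ-node cs = trans (map-++ toℕEdge (map _ (froots cs)) (map _ (fedges cs))) (cong₂ _++_
  (trans (map-∘-cong {h = (λ r → 0 , suc r) ∘ toℕ} (λ _ → refl) (froots cs)) (map-∘ (froots cs)))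
  (trans (map-∘-cong {h = shift 1 ∘ toℕEdge} (λ _ → refl) (fedges cs)) (map-∘ (fedges cs))))

length-rootsℕ : ∀ ts → length (rootsℕ ts) ≡ length ts
length-rootsℕ ts = trans (length-map toℕ (froots ts)) (length-froots ts)
  where length-froots : ∀ ts → length (froots ts) ≡ length ts
        length-froots []       = refl
        length-froots (t ∷ ts) = cong suc (trans (length-map _ (froots ts)) (length-froots ts))

fsize-nonZero : ∀ ts → 0 < length ts → NonZero (fsize ts)
fsize-nonZero (node cs ∷ ts) _ = _

-- Vertices are numbered in preorder, tree after tree.
mutual
  depth : Tree → ℕ → ℕ
  depth (node cs) zero    = 0
  depth (node cs) (suc w) = suc (forestDepth cs w)

  forestDepth : List Tree → ℕ → ℕ
  forestDepth []       w = 0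
  forestDepth (t ∷ ts) w = if does (w <? tsize t) then depth t w else forestDepth ts (w ∸ tsize t)

treeIndex : List Tree → ℕ → ℕ
treeIndex []       w = 0
treeIndex (t ∷ ts) w = if does (w <? tsize t) then 0 else suc (treeIndex ts (w ∸ tsize t))

module _ {t : Tree} {ts : List Tree} where

  forestDepth-here : ∀ {w} → w < tsize t → forestDepth (t ∷ ts) w ≡ depth t w
  forestDepth-here {w} w< rewrite dec-true (w <? tsize t) w< = refl

  forestDepth-there : ∀ w → forestDepth (t ∷ ts) (tsize t + w) ≡ forestDepth ts w
  forestDepth-there w rewrite dec-false (tsize t + w <? tsize t) (≤⇒≯ (m≤m+n _ w)) | m+n∸m≡n (tsize t) w = refl

  treeIndex-here : ∀ {w} → w < tsize t → treeIndex (t ∷ ts) w ≡ 0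
  treeIndex-here {w} w< rewrite dec-true (w <? tsize t) w< = refl

  treeIndex-there : ∀ w → treeIndex (t ∷ ts) (tsize t + w) ≡ suc (treeIndex ts w)
  treeIndex-there w rewrite dec-false (tsize t + w <? tsize t) (≤⇒≯ (m≤m+n _ w)) | m+n∸m≡n (tsize t) w = refl

IsRoot : List Tree → ℕ → Set
IsRoot ts r = forestDepth ts r ≡ 0 × r < fsize ts

TreeStep : Tree → Edge → Set
TreeStep t (u , v) = depth t v ≡ suc (depth t u) × u < tsize t × v < tsize t

ForestStep : List Tree → Edge → Set
ForestStep ts (u , v) = forestDepth ts v ≡ suc (forestDepth ts u) × treeIndex ts v ≡ treeIndex ts u × u < fsize ts × v < fsize ts

rootsℕ-IsRoot : ∀ ts → All (IsRoot ts) (rootsℕ ts)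
rootsℕ-IsRoot []              = []
rootsℕ-IsRoot (node cs ∷ ts) rewrite rootsℕ-∷ cs ts =
  (refl , s≤s z≤n) ∷ map⁺ (All.map (λ {r} (d , r<) → trans (forestDepth-there {node cs} {ts} r) d , +-monoʳ-< (suc (fsize cs)) r<)
                                   (rootsℕ-IsRoot ts))

mutual
  treeEdgesℕ-TreeStep : ∀ t → All (TreeStep t) (treeEdgesℕ t)
  treeEdgesℕ-TreeStep (node cs) rewrite treeEdgesℕ-node cs =
    ++⁺ (map⁺ (All.map (λ (d , r<) → cong suc d , s≤s z≤n , s≤s r<) (rootsℕ-IsRoot cs)))
        (map⁺ (All.map (λ (d , _ , u< , v<) → cong suc d , s≤s u< , s≤s v<) (forestEdgesℕ-ForestStep cs)))

  forestEdgesℕ-ForestStep : ∀ ts → All (ForestStep ts) (forestEdgesℕ ts)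
  forestEdgesℕ-ForestStep []       = []
  forestEdgesℕ-ForestStep (t ∷ ts) rewrite forestEdgesℕ-∷ t ts =
    ++⁺ (All.map here (treeEdgesℕ-TreeStep t)) (map⁺ (All.map there (forestEdgesℕ-ForestStep ts)))
    where
    here : ∀ {e} → TreeStep t e → ForestStep (t ∷ ts) e
    here (d , u< , v<) =
      trans (forestDepth-here {t} {ts} v<) (trans d (cong suc (sym (forestDepth-here {t} {ts} u<)))) ,
      trans (treeIndex-here {t} {ts} v<) (sym (treeIndex-here {t} {ts} u<)) ,
      ≤-trans u< (m≤m+n _ _) , ≤-trans v< (m≤m+n _ _)
    there : ∀ {e} → ForestStep ts e → ForestStep (t ∷ ts) (shift (tsize t) e)
    there {u , v} (d , i , u< , v<) =
      trans (forestDepth-there {t} {ts} v) (trans d (cong suc (sym (forestDepth-there {t} {ts} u)))) ,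
      trans (treeIndex-there {t} {ts} v) (trans (cong suc i) (sym (treeIndex-there {t} {ts} u))) ,
      +-monoʳ-< (tsize t) u< , +-monoʳ-< (tsize t) v<

treeIndex-rootsℕ : ∀ ts {j} → j < length ts → treeIndex ts (rootsℕ ts !ₙ j) ≡ j
treeIndex-rootsℕ (node cs ∷ ts) {zero}  _         = refl
treeIndex-rootsℕ (node cs ∷ ts) {suc j} (s≤s j<) = begin
  treeIndex (node cs ∷ ts) (rootsℕ (node cs ∷ ts) !ₙ suc j)           ≡⟨ cong (λ rs → treeIndex (node cs ∷ ts) (rs !ₙ suc j)) (rootsℕ-∷ cs ts) ⟩
  treeIndex (node cs ∷ ts) (map (tsize (node cs) +_) (rootsℕ ts) !ₙ j) ≡⟨ cong (treeIndex (node cs ∷ ts)) (nth-map _ (rootsℕ ts) (subst (j <_) (sym (length-rootsℕ ts)) j<)) ⟩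
  treeIndex (node cs ∷ ts) (tsize (node cs) + rootsℕ ts !ₙ j)         ≡⟨ treeIndex-there {node cs} {ts} (rootsℕ ts !ₙ j) ⟩
  suc (treeIndex ts (rootsℕ ts !ₙ j))                                  ≡⟨ cong suc (treeIndex-rootsℕ ts j<) ⟩
  suc j                                                                ∎
  where open ≡-Reasoning

fsize-++ : ∀ xs ys → fsize (xs ++ ys) ≡ fsize xs + fsize ys
fsize-++ []       ys = refl
fsize-++ (t ∷ xs) ys = trans (cong (tsize t +_) (fsize-++ xs ys)) (sym (+-assoc (tsize t) _ _))

forestEdgesℕ-++ : ∀ xs ys → forestEdgesℕ (xs ++ ys) ≡ forestEdgesℕ xs ++ map (shift (fsize xs)) (forestEdgesℕ ys)
forestEdgesℕ-++ []       ys = sym (map-id (forestEdgesℕ ys))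
forestEdgesℕ-++ (t ∷ xs) ys = begin
  forestEdgesℕ (t ∷ (xs ++ ys))                                                      ≡⟨ forestEdgesℕ-∷ t (xs ++ ys) ⟩
  Eₜ ++ map (shift (tsize t)) (forestEdgesℕ (xs ++ ys))                              ≡⟨ cong (λ es → Eₜ ++ map (shift (tsize t)) es) (forestEdgesℕ-++ xs ys) ⟩
  Eₜ ++ map (shift (tsize t)) (forestEdgesℕ xs ++ map (shift (fsize xs)) Eys)        ≡⟨ cong (Eₜ ++_) (map-++ (shift (tsize t)) (forestEdgesℕ xs) _) ⟩
  Eₜ ++ (map (shift (tsize t)) (forestEdgesℕ xs) ++ map (shift (tsize t)) (map (shift (fsize xs)) Eys))
    ≡⟨ cong (λ es → Eₜ ++ (map (shift (tsize t)) (forestEdgesℕ xs) ++ es)) (map-shift-shift (tsize t) (fsize xs) Eys) ⟩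
  Eₜ ++ (map (shift (tsize t)) (forestEdgesℕ xs) ++ map (shift (tsize t + fsize xs)) Eys) ≡⟨ ++-assoc Eₜ _ _ ⟨
  (Eₜ ++ map (shift (tsize t)) (forestEdgesℕ xs)) ++ map (shift (tsize t + fsize xs)) Eys ≡⟨ cong (_++ map (shift (tsize t + fsize xs)) Eys) (forestEdgesℕ-∷ t xs) ⟨
  forestEdgesℕ (t ∷ xs) ++ map (shift (fsize (t ∷ xs))) Eys                          ∎
  where open ≡-Reasoning
        Eₜ = treeEdgesℕ t
        Eys = forestEdgesℕ ys

rootsℕ-++ : ∀ xs ys → rootsℕ (xs ++ ys) ≡ rootsℕ xs ++ map (fsize xs +_) (rootsℕ ys)
rootsℕ-++ []             ys = sym (map-id (rootsℕ ys))
rootsℕ-++ (node cs ∷ xs) ys = begin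
  rootsℕ (node cs ∷ (xs ++ ys))                                            ≡⟨ rootsℕ-∷ cs (xs ++ ys) ⟩
  0 ∷ map (k +_) (rootsℕ (xs ++ ys))                                       ≡⟨ cong (λ rs → 0 ∷ map (k +_) rs) (rootsℕ-++ xs ys) ⟩
  0 ∷ map (k +_) (rootsℕ xs ++ map (fsize xs +_) (rootsℕ ys))              ≡⟨ cong (0 ∷_) (map-++ (k +_) (rootsℕ xs) _) ⟩
  0 ∷ (map (k +_) (rootsℕ xs) ++ map (k +_) (map (fsize xs +_) (rootsℕ ys))) ≡⟨ cong (λ rs → 0 ∷ (map (k +_) (rootsℕ xs) ++ rs)) k+ ⟩
  (0 ∷ map (k +_) (rootsℕ xs)) ++ map ((k + fsize xs) +_) (rootsℕ ys)      ≡⟨ cong (_++ map ((k + fsize xs) +_) (rootsℕ ys)) (rootsℕ-∷ cs xs) ⟨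
  rootsℕ (node cs ∷ xs) ++ map (fsize (node cs ∷ xs) +_) (rootsℕ ys)       ∎
  where open ≡-Reasoning
        k = tsize (node cs)
        k+ : map (k +_) (map (fsize xs +_) (rootsℕ ys)) ≡ map ((k + fsize xs) +_) (rootsℕ ys)
        k+ = map-∘-cong (λ r → sym (+-assoc k (fsize xs) r)) (rootsℕ ys)

repeatShifted : {A : Set} → (ℕ → A → A) → ℕ → ℕ → List A → List A
repeatShifted act zero    p xs = []
repeatShifted act (suc k) p xs = xs ++ map (act p) (repeatShifted act k p xs)

length-repeatShifted : ∀ {A : Set} (act : ℕ → A → A) k p xs → length (repeatShifted act k p xs) ≡ k * length xs
length-repeatShifted act zero    p xs = refl
length-repeatShifted act (suc k) p xs =
  trans (length-++ xs) (cong (length xs +_) (trans (length-map (act p) (repeatShifted act k p xs)) (length-repeatShifted act k p xs)))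

module _ {A : Set} {act : ℕ → A → A} {d : A}
         (act-0 : ∀ x → act 0 x ≡ x) (act-+ : ∀ a b x → act a (act b x) ≡ act (a + b) x) where

  nth-repeatShifted : ∀ k p xs {b j} → b < k → j < length xs →
                      nth d (repeatShifted act k p xs) (b * length xs + j) ≡ act (b * p) (nth d xs j)
  nth-repeatShifted (suc k) p xs {zero}  {j} _ j< = trans (nth-++ˡ xs _ j<) (sym (act-0 _))
  nth-repeatShifted (suc k) p xs {suc b} {j} (s≤s b<k) j< = begin
    nth d (xs ++ Rest) (length xs + b * length xs + j)   ≡⟨ cong (nth d (xs ++ Rest)) (+-assoc (length xs) _ j) ⟩
    nth d (xs ++ Rest) (length xs + (b * length xs + j)) ≡⟨ nth-++ʳ xs Rest _ ⟩
    nth d Rest (b * length xs + j)                       ≡⟨ nth-map (act p) (repeatShifted act k p xs) in-range ⟩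
    act p (nth d (repeatShifted act k p xs) (b * length xs + j)) ≡⟨ cong (act p) (nth-repeatShifted k p xs b<k j<) ⟩
    act p (act (b * p) (nth d xs j))                     ≡⟨ act-+ p (b * p) _ ⟩
    act (suc b * p) (nth d xs j)                         ∎
    where
    open ≡-Reasoning
    Rest = map (act p) (repeatShifted act k p xs)
    in-range : b * length xs + j < length (repeatShifted act k p xs)
    in-range = subst (b * length xs + j <_) (sym (length-repeatShifted act k p xs)) (m*n+o<k*n b<k j<)

nth-repeatShifted-edges : ∀ k p xs {b j} → b < k → j < length xs →
                          repeatShifted shift k p xs ! (b * length xs + j) ≡ shift (b * p) (xs ! j)
nth-repeatShifted-edges = nth-repeatShifted (λ _ → refl) (λ a b x → mapEdge-cong (λ w → sym (+-assoc a b w)) x)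

nth-repeatShifted-ℕ : ∀ k p xs {b j} → b < k → j < length xs →
                      repeatShifted _+_ k p xs !ₙ (b * length xs + j) ≡ b * p + xs !ₙ j
nth-repeatShifted-ℕ = nth-repeatShifted (λ _ → refl) (λ a b x → sym (+-assoc a b x))

power : ℕ → List Tree → List Tree
power k ts = concat (replicate k ts)

fsize-power : ∀ k ts → fsize (power k ts) ≡ k * fsize ts
fsize-power zero    ts = refl
fsize-power (suc k) ts = trans (fsize-++ ts (power k ts)) (cong (fsize ts +_) (fsize-power k ts))

forestEdgesℕ-power : ∀ k ts → forestEdgesℕ (power k ts) ≡ repeatShifted shift k (fsize ts) (forestEdgesℕ ts)
forestEdgesℕ-power zero    ts = refl
forestEdgesℕ-power (suc k) ts =
  trans (forestEdgesℕ-++ ts (power k ts)) (cong (λ es → forestEdgesℕ ts ++ map (shift (fsize ts)) es) (forestEdgesℕ-power k ts))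

rootsℕ-power : ∀ k ts → rootsℕ (power k ts) ≡ repeatShifted _+_ k (fsize ts) (rootsℕ ts)
rootsℕ-power zero    ts = refl
rootsℕ-power (suc k) ts =
  trans (rootsℕ-++ ts (power k ts)) (cong (λ rs → rootsℕ ts ++ map (fsize ts +_) rs) (rootsℕ-power k ts))

map-cycleEdges : ∀ {A B : Set} (f : A → B) xs → map (mapEdge f) (cycleEdges xs) ≡ cycleEdges (map f xs)
map-cycleEdges f []       = refl
map-cycleEdges f (x ∷ xs) = begin
  map (mapEdge f) (zip (x ∷ xs) (xs ++ [ x ]))        ≡⟨ map-zipWith _,_ (mapEdge f) (x ∷ xs) (xs ++ [ x ]) ⟩
  zipWith (λ u v → f u , f v) (x ∷ xs) (xs ++ [ x ])  ≡⟨ zipWith-map _,_ f f (x ∷ xs) (xs ++ [ x ]) ⟨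
  zip (f x ∷ map f xs) (map f (xs ++ [ x ]))          ≡⟨ cong (zip (f x ∷ map f xs)) (map-++ f xs [ x ]) ⟩
  zip (f x ∷ map f xs) (map f xs ++ [ f x ])          ∎
  where open ≡-Reasoning

length-++-[] : ∀ {A : Set} (xs : List A) x → length (xs ++ [ x ]) ≡ suc (length xs)
length-++-[] xs x = trans (length-++ xs) (+-comm (length xs) 1)

length-cycleEdges : ∀ {A : Set} (xs : List A) → length (cycleEdges xs) ≡ length xs
length-cycleEdges []       = refl
length-cycleEdges (x ∷ xs) = trans (length-zipWith _,_ (x ∷ xs) (xs ++ [ x ]))
  (trans (cong (suc (length xs) ⊓_) (length-++-[] xs x)) (⊓-idem _))

nth-zip : ∀ xs ys {i} → i < length xs → i < length ys → zip xs ys ! i ≡ (xs !ₙ i , ys !ₙ i)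
nth-zip (x ∷ xs) (y ∷ ys) {zero}  _          _          = refl
nth-zip (x ∷ xs) (y ∷ ys) {suc i} (s≤s i<xs) (s≤s i<ys) = nth-zip xs ys i<xs i<ys

cycleEdges-inner : ∀ xs {i} → suc i < length xs → cycleEdges xs ! i ≡ (xs !ₙ i , xs !ₙ suc i)
cycleEdges-inner (x ∷ xs) {i} (s≤s i+1<) =
  trans (nth-zip (x ∷ xs) (xs ++ [ x ]) (<-trans (n<1+n i) (s≤s i+1<)) (subst (i <_) (sym (length-++-[] xs x)) (<-trans i+1< (n<1+n _))))
        (cong ((x ∷ xs) !ₙ i ,_) (nth-++ˡ xs [ x ] i+1<))

cycleEdges-last : ∀ xs {i} → suc i ≡ length xs → cycleEdges xs ! i ≡ (xs !ₙ i , xs !ₙ 0)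
cycleEdges-last (x ∷ xs) {i} i+1≡ =
  trans (nth-zip (x ∷ xs) (xs ++ [ x ]) (subst (i <_) i+1≡ ≤-refl) (subst (i <_) (trans i+1≡ (sym (length-++-[] xs x))) ≤-refl))
        (cong ((x ∷ xs) !ₙ i ,_) (trans (cong ((xs ++ [ x ]) !ₙ_) (trans (suc-injective i+1≡) (sym (+-identityʳ (length xs))))) (nth-++ʳ xs [ x ] 0)))

cycleGraph : List Tree → ℕGraph
cycleGraph ts = ℕgraph (fsize ts) (forestEdgesℕ ts ++ cycleEdges (rootsℕ ts))

toℕGraph-unicyclic : ∀ ts → toℕGraph (unicyclic ts) ≡ cycleGraph ts
toℕGraph-unicyclic ts = cong (ℕgraph (fsize ts)) (trans (map-++ toℕEdge (fedges ts) _) (cong (forestEdgesℕ ts ++_) (map-cycleEdges toℕ (froots ts))))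

toℕGraph-copies : ∀ k G → toℕGraph (copies k G) ≡ ℕgraph (k * order G) (repeatShifted shift k (order G) (elist (toℕGraph G)))
toℕGraph-copies zero    G = refl
toℕGraph-copies (suc k) G = trans (toℕGraph-⊕ G (copies k G)) (cong (toℕGraph G ⊕ℕ_) (toℕGraph-copies k G))

cycleEdges-source : ∀ xs {i} → i < length xs → proj₁ (cycleEdges xs ! i) ≡ xs !ₙ i
cycleEdges-source xs {i} i< with suc i <? length xs
... | yes i+1< = cong proj₁ (cycleEdges-inner xs i+1<)
... | no i+1≮ = cong proj₁ (cycleEdges-last xs (≤-antisym i< (≮⇒≥ i+1≮)))

cycleEdges-target : ∀ xs {m} .{{_ : NonZero m}} → length xs ≡ m → ∀ {i} → i < m → proj₂ (cycleEdges xs ! i) ≡ xs !ₙ (suc i % m)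
cycleEdges-target xs {m} refl {i} i< with suc i <? length xs
... | yes i+1< = trans (cong proj₂ (cycleEdges-inner xs i+1<)) (cong (xs !ₙ_) (sym (m<n⇒m%n≡m i+1<)))
... | no i+1≮ = trans (cong proj₂ (cycleEdges-last xs i+1≡)) (cong (xs !ₙ_) (sym (trans (%-congˡ i+1≡) (n%n≡0 m))))
  where i+1≡ = ≤-antisym i< (≮⇒≥ i+1≮)

-- Cyclic lifts and potentials

-- On a cycle of length m whose edges are listed a₁a₂, …, a_m a₁, only the last edge is twisted.
closingTwist : ℕ → ℕ → ℕ → ℕ
closingTwist m t j = if does (j <? m ∸ 1) then 0 else t

module Lifting (s : ℕ) where
  open OddModulus s
  open Covering s

  -- H (edge list EH, vertices b · p + u for b < n, u < p) is the n-fold cyclic lift of G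
  -- (edge list EG, p vertices): the edge of H in block b over the edge u → v of G runs from
  -- b · p + u to b′ · p + v, where b′ = b + twistOf (that edge of G) mod n.
  record CyclicLift (p : ℕ) (twistOf : ℕ → ℕ) (EG EH : List Edge) : Set where
    field
      baseOf blockOf : ℕ → ℕ
      ecount≡   : length EH ≡ n * length EG
      baseOf<   : ∀ {e} → e < length EH → baseOf e < length EG
      blockOf<  : ∀ {e} → e < length EH → blockOf e < n
      source≡   : ∀ {e} → e < length EH → proj₁ (EH ! e) ≡ blockOf e * p + proj₁ (EG ! baseOf e)
      target≡   : ∀ {e} → e < length EH →
                  proj₂ (EH ! e) ≡ ((blockOf e + twistOf (baseOf e)) % n) * p + proj₂ (EG ! baseOf e)
      block-base-injective : ∀ {e e′} → e < length EH → e′ < length EH →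
                             blockOf e ≡ blockOf e′ → baseOf e ≡ baseOf e′ → e ≡ e′

  -- Vertex b · p + u of the lift gets fibre index b · A + δ u mod n; if along every edge u → v
  -- of G the potential δ satisfies δ v + twist · A ≡ δ u + t with t ∈ {s, s + 1}, the endpoint
  -- fibres of each lifted edge are x and x + t mod n, and x ↦ x + (x + t) mod n is injective
  -- with values in [s, 3s], so 3s minus that sum is a valid, injective edge fibre.
  module PotentialCover {p : ℕ} .{{_ : NonZero p}} {twistOf : ℕ → ℕ} {EG EH : List Edge} (L : CyclicLift p twistOf EG EH)
    (G-wf : WellFormed (ℕgraph p EG)) (A : ℕ) (A-injective : MulInjective A) (δ step : ℕ → ℕ)
    (step-half : ∀ {e} → e < length EG → HalfShift (step e))
    (potential : ∀ {e} → e < length EG →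
                 (δ (proj₂ (EG ! e)) + twistOf e * A) % n ≡ (δ (proj₁ (EG ! e)) + step e) % n) where
    open CyclicLift L

    vbase vfibre : ℕ → ℕ
    vbase w  = w % p
    vfibre w = ((w / p) * A + δ (w % p)) % n

    source target : ℕ → ℕ
    source e = proj₁ (EH ! e)
    target e = proj₂ (EH ! e)

    endpointSum : ℕ → ℕ
    endpointSum e = vfibre (source e) + vfibre (target e)

    efibre : ℕ → ℕ
    efibre e = fibreSum ∸ endpointSum e

    vfibre< : ∀ {w} → vfibre w < n
    vfibre< {w} = m%n<n ((w / p) * A + δ (w % p)) n

    v-injective : ∀ {w w′} → w < n * p → w′ < n * p → vbase w ≡ vbase w′ → vfibre w ≡ vfibre w′ → w ≡ w′
    v-injective {w} {w′} w< w′< %≡ fibre≡ = begin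
      w                   ≡⟨ m≡[m/n]*n+m%n w p ⟩
      (w / p) * p + w % p ≡⟨ cong₂ (λ a b → a * p + b) /≡ %≡ ⟩
      (w′ / p) * p + w′ % p ≡⟨ m≡[m/n]*n+m%n w′ p ⟨
      w′                  ∎
      where
      open ≡-Reasoning
      /≡ : w / p ≡ w′ / p
      /≡ = A-injective (m<n*o⇒m/o<n w<) (m<n*o⇒m/o<n w′<) (trans fibre≡ (cong (λ u → ((w′ / p) * A + δ u) % n) (sym %≡)))

    record LiftedEdge (e : ℕ) : Set where
      field
        source%p : source e % p ≡ proj₁ (EG ! baseOf e)
        source/p : source e / p ≡ blockOf e
        target%p : target e % p ≡ proj₂ (EG ! baseOf e)
        target-fibre : vfibre (target e) ≡ (vfibre (source e) + step (baseOf e)) % n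

    liftedEdge : ∀ {e} → e < length EH → LiftedEdge e
    liftedEdge {e} e< = record { source%p = source%p ; source/p = source/p ; target%p = target%p ; target-fibre = target-fibre }
      where
      g = baseOf e
      u = proj₁ (EG ! g)
      v = proj₂ (EG ! g)
      b = blockOf e
      b′ = (b + twistOf g) % n
      u<p = proj₁ (G-wf (baseOf< e<))
      v<p = proj₂ (G-wf (baseOf< e<))
      source%p : source e % p ≡ u
      source%p = trans (cong (_% p) (source≡ e<)) ([m*n+o]%n≡o b p u<p)
      source/p : source e / p ≡ b
      source/p = trans (cong (_/ p) (source≡ e<)) ([m*n+o]/n≡m b p u<p)
      target%p : target e % p ≡ v
      target%p = trans (cong (_% p) (target≡ e<)) ([m*n+o]%n≡o b′ p v<p)
      target/p : target e / p ≡ b′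
      target/p = trans (cong (_/ p) (target≡ e<)) ([m*n+o]/n≡m b′ p v<p)
      ring : ∀ b t A d → (b + t) * A + d ≡ b * A + (d + t * A)
      ring = solve-∀
      target-fibre : vfibre (target e) ≡ (vfibre (source e) + step g) % n
      target-fibre = begin
        vfibre (target e)                        ≡⟨ cong₂ (λ x y → (x * A + δ y) % n) target/p target%p ⟩
        (b′ * A + δ v) % n                       ≡⟨ %-cong-+ʳ n {b′ * A} {(b + twistOf g) * A} (δ v) (%-cong-*ʳ n {b′} {b + twistOf g} A (m%n%n≡m%n (b + twistOf g) n)) ⟩
        ((b + twistOf g) * A + δ v) % n          ≡⟨ cong (_% n) (ring b (twistOf g) A (δ v)) ⟩
        (b * A + (δ v + twistOf g * A)) % n      ≡⟨ %-cong-+ˡ n (b * A) (potential (baseOf< e<)) ⟩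
        (b * A + (δ u + step g)) % n             ≡⟨ cong (_% n) (+-assoc (b * A) (δ u) (step g)) ⟨
        (b * A + δ u + step g) % n               ≡⟨ %-cong-+ʳ n {(b * A + δ u) % n} {b * A + δ u} (step g) (m%n%n≡m%n (b * A + δ u) n) ⟨
        ((b * A + δ u) % n + step g) % n         ≡⟨ cong (λ x → (x + step g) % n) (cong₂ (λ x y → (x * A + δ y) % n) source/p source%p) ⟨
        (vfibre (source e) + step g) % n         ∎
        where open ≡-Reasoning

    endpointSum-twist : ∀ {e} → e < length EH → endpointSum e ≡ twist (step (baseOf e)) (vfibre (source e))
    endpointSum-twist {e} e< = cong (vfibre (source e) +_) (LiftedEdge.target-fibre (liftedEdge e<))

    endpointSum-bounds : ∀ {e} → e < length EH → s ≤ endpointSum e × endpointSum e ≤ fibreSum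
    endpointSum-bounds e< rewrite endpointSum-twist e< =
      s≤twist (step-half (baseOf< e<)) vfibre< , twist≤fibreSum (step-half (baseOf< e<)) vfibre<

    efibre< : ∀ {e} → e < length EH → efibre e < n
    efibre< e< = s≤s (≤-trans (∸-monoʳ-≤ fibreSum (proj₁ (endpointSum-bounds e<))) (≤-reflexive (m+n∸m≡n s (s + s))))

    source< : ∀ {e} → e < length EH → source e < n * p
    source< e< = subst (_< n * p) (sym (source≡ e<)) (m*n+o<k*n (blockOf< e<) (proj₁ (G-wf (baseOf< e<))))

    e-injective : ∀ {e e′} → e < length EH → e′ < length EH → baseOf e ≡ baseOf e′ → efibre e ≡ efibre e′ → e ≡ e′
    e-injective {e} {e′} e< e′< base≡ efibre≡ = block-base-injective e< e′< block≡ base≡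
      where
      sum≡ : endpointSum e ≡ endpointSum e′
      sum≡ = trans (sym (m∸[m∸n]≡n (proj₂ (endpointSum-bounds e<))))
                   (trans (cong (fibreSum ∸_) efibre≡) (m∸[m∸n]≡n (proj₂ (endpointSum-bounds e′<))))
      fibre≡ : vfibre (source e) ≡ vfibre (source e′)
      fibre≡ = twist-injective (step-half (baseOf< e<)) vfibre< vfibre<
        (trans (sym (endpointSum-twist e<)) (trans sum≡ (trans (endpointSum-twist e′<) (cong (λ g → twist (step g) (vfibre (source e′))) (sym base≡)))))
      %p≡ : vbase (source e) ≡ vbase (source e′)
      %p≡ = trans (LiftedEdge.source%p (liftedEdge e<)) (trans (cong (λ g → proj₁ (EG ! g)) base≡) (sym (LiftedEdge.source%p (liftedEdge e′<))))
      block≡ : blockOf e ≡ blockOf e′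
      block≡ = trans (sym (LiftedEdge.source/p (liftedEdge e<)))
                     (trans (cong (_/ p) (v-injective (source< e<) (source< e′<) %p≡ fibre≡)) (LiftedEdge.source/p (liftedEdge e′<)))

    cover : Cover (ℕgraph (n * p) EH) (ℕgraph p EG)
    cover = record
      { vbase = vbase ; vfibre = vfibre ; ebase = baseOf ; efibre = efibre
      ; vbase< = λ {w} _ → m%n<n w p ; vfibre< = λ _ → vfibre< ; ebase< = baseOf< ; efibre< = efibre<
      ; v-injective = v-injective ; e-injective = e-injective
      ; vcount≡ = refl ; ecount≡ = ecount≡
      ; edge-base = λ e< → cong₂ _,_ (LiftedEdge.source%p (liftedEdge e<)) (LiftedEdge.target%p (liftedEdge e<))
      ; fibre-sum = λ e< → m+[n∸m]≡n (proj₂ (endpointSum-bounds e<)) }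

-- A potential on the unicyclic graph (T₁(w₁), …, T_m(w_m)) given by forest edges followed by the
-- cycle edges a₁a₂, …, a_{m-1}a_m, a_m a₁: a vertex at depth d in T_j gets the potential of a_j plus
-- s · d, and along the cycle the potential rises by s up to a_P and then falls by s, which modulo n
-- is a rise by s + 1.  Only the closing edge a_m a₁ carries the twist t₀.
module CyclePotential (s : ℕ) (ts : List Tree) (P c₀ t₀ A : ℕ) where
  open OddModulus s

  m p qT : ℕ
  m  = length ts
  p  = fsize ts
  qT = length (forestEdgesℕ ts)

  R : List ℕ
  R = rootsℕ ts

  EG : List Edge
  EG = forestEdgesℕ ts ++ cycleEdges R

  D : ℕ
  D = c₀ + s * (P + P)

  cyclePotential : ℕ → ℕ
  cyclePotential j = if does (P <? j) then D ∸ s * j else c₀ + s * j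

  cycleStep : ℕ → ℕ
  cycleStep j = if does (j <? P) then s else suc s

  δ : ℕ → ℕ
  δ u = cyclePotential (treeIndex ts u) + s * forestDepth ts u

  twistOf : ℕ → ℕ
  twistOf = joinAt qT (λ _ → 0) (closingTwist m t₀)

  step : ℕ → ℕ
  step = joinAt qT (λ _ → s) cycleStep

  step-half : ∀ e → HalfShift (step e)
  step-half e with does (e <? qT)
  ... | true = half
  ... | false with does (e ∸ qT <? P)
  ...   | true  = half
  ...   | false = half⁺

  length-EG : length EG ≡ qT + m
  length-EG = trans (length-++ (forestEdgesℕ ts)) (cong (qT +_) (trans (length-cycleEdges R) (length-rootsℕ ts)))

  cyclePotential-≤ : ∀ {j} → j ≤ P → cyclePotential j ≡ c₀ + s * j
  cyclePotential-≤ {j} j≤P rewrite dec-false (P <? j) (≤⇒≯ j≤P) = refl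

  cyclePotential-≥ : ∀ {j} → P ≤ j → cyclePotential j ≡ D ∸ s * j
  cyclePotential-≥ {j} P≤j with m≤n⇒m<n∨m≡n P≤j
  ... | inj₁ P<j rewrite dec-true (P <? j) P<j = refl
  ... | inj₂ refl rewrite dec-false (P <? P) (<-irrefl refl) =
    sym (trans (cong (_∸ s * P) (ring c₀ s P)) (m+n∸n≡m (c₀ + s * P) (s * P)))
    where ring : ∀ c₀ s P → c₀ + s * (P + P) ≡ c₀ + s * P + s * P
          ring = solve-∀

  cyclePotential-0 : cyclePotential 0 ≡ c₀
  cyclePotential-0 = trans (cyclePotential-≤ z≤n) (trans (cong (c₀ +_) (*-zeroʳ s)) (+-identityʳ c₀))

  cycleStep-< : ∀ {j} → j < P → cycleStep j ≡ s
  cycleStep-< {j} j<P rewrite dec-true (j <? P) j<P = refl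

  cycleStep-≥ : ∀ {j} → P ≤ j → cycleStep j ≡ suc s
  cycleStep-≥ {j} P≤j rewrite dec-false (j <? P) (≤⇒≯ P≤j) = refl

  -- D-large rules out truncation in D ∸ s · j along the cycle.
  module _ (D-large : s * (m ∸ 1) ≤ D) where

    cyclePotential-step : ∀ {j} → suc j < m → cyclePotential (suc j) % n ≡ (cyclePotential j + cycleStep j) % n
    cyclePotential-step {j} j+1<m with j <? P
    ... | yes j<P rewrite dec-true (j <? P) j<P | cyclePotential-≤ {suc j} j<P | cyclePotential-≤ {j} (<⇒≤ j<P) =
      cong (_% n) (ring c₀ s j)
      where ring : ∀ c₀ s j → c₀ + s * suc j ≡ c₀ + s * j + s
            ring = solve-∀
    ... | no j≮P rewrite dec-false (j <? P) j≮P = begin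
      cyclePotential (suc j) % n        ≡⟨ cong (_% n) (cyclePotential-≥ (≤-trans P≤j (n≤1+n j))) ⟩
      X % n                             ≡⟨ [m+n]%n≡m%n X n ⟨
      (X + n) % n                       ≡⟨ cong (_% n) (ring X s) ⟩
      (X + s + suc s) % n               ≡⟨ cong (λ x → (x + suc s) % n) previous ⟨
      (cyclePotential j + suc s) % n    ∎
      where
      open ≡-Reasoning
      P≤j : P ≤ j
      P≤j = ≮⇒≥ j≮P
      X = D ∸ s * suc j
      s[j+1]≤D : s * suc j ≤ D
      s[j+1]≤D = ≤-trans (*-monoʳ-≤ s (≤-pred (subst (suc j <_) (sym (suc-pred m {{>-nonZero (<-trans z<s j+1<m)}})) j+1<m))) D-large
      ring : ∀ X s → X + suc (s + s) ≡ X + s + suc s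
      ring = solve-∀
      previous : cyclePotential j ≡ X + s
      previous = begin
        cyclePotential j          ≡⟨ cyclePotential-≥ P≤j ⟩
        D ∸ s * j                 ≡⟨ cong (_∸ s * j) (m∸n+n≡m s[j+1]≤D) ⟨
        X + s * suc j ∸ s * j     ≡⟨ cong (_∸ s * j) (ring′ X s j) ⟩
        X + s + s * j ∸ s * j     ≡⟨ m+n∸n≡m (X + s) (s * j) ⟩
        X + s                     ∎
        where ring′ : ∀ X s j → X + s * suc j ≡ X + s + s * j
              ring′ = solve-∀

    δ-root : ∀ {j} → j < m → δ (R !ₙ j) ≡ cyclePotential j
    δ-root {j} j<m rewrite treeIndex-rootsℕ ts j<m
                        | proj₁ (All-nth {d = 0} (rootsℕ-IsRoot ts) (subst (j <_) (sym (length-rootsℕ ts)) j<m))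
                        | *-zeroʳ s = +-identityʳ (cyclePotential j)

    module _ (closing : (cyclePotential 0 + t₀ * A) % n ≡ (cyclePotential (m ∸ 1) + cycleStep (m ∸ 1)) % n) where

      potential : ∀ {e} → e < length EG → (δ (proj₂ (EG ! e)) + twistOf e * A) % n ≡ (δ (proj₁ (EG ! e)) + step e) % n
      potential {e} e< with e <? qT
      ... | yes e<qT rewrite nth-++ˡ {d = 0 , 0} (forestEdgesℕ ts) (cycleEdges R) e<qT
                          | joinAt-< {f = λ _ → 0} {closingTwist m t₀} e<qT | joinAt-< {f = λ _ → s} {cycleStep} e<qT =
        cong (_% n) (trans (+-identityʳ _) one-level-down)
        where
        u = proj₁ (forestEdgesℕ ts ! e)
        v = proj₂ (forestEdgesℕ ts ! e)
        one-level-down : δ v ≡ δ u + s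
        one-level-down with All-nth {d = 0 , 0} (forestEdgesℕ-ForestStep ts) e<qT
        ... | depth≡ , index≡ , _ rewrite depth≡ | index≡ = ring (cyclePotential (treeIndex ts u)) s (forestDepth ts u)
          where ring : ∀ x s d → x + s * suc d ≡ x + s * d + s
                ring = solve-∀
      ... | no e≮qT with m≤n⇒∃[o]m+o≡n (≮⇒≥ e≮qT)
      ...   | j , refl = cycle-edge
        where
        j<m : j < m
        j<m = +-cancelˡ-< qT j m (subst (qT + j <_) length-EG e<)
        EG≡ : EG ! (qT + j) ≡ cycleEdges R ! j
        EG≡ = nth-++ʳ (forestEdgesℕ ts) (cycleEdges R) j
        length-R : length R ≡ m
        length-R = length-rootsℕ ts
        last : ¬ suc j < m → suc j ≡ m
        last j+1≮m = ≤-antisym j<m (≮⇒≥ j+1≮m)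
        cycle-edge : (δ (proj₂ (EG ! (qT + j))) + twistOf (qT + j) * A) % n ≡ (δ (proj₁ (EG ! (qT + j))) + step (qT + j)) % n
        cycle-edge with suc j <? m
        ... | yes j+1<m rewrite EG≡ | cycleEdges-inner R (subst (suc j <_) (sym length-R) j+1<m)
                              | joinAt-+ {qT} {λ _ → s} {cycleStep} j | joinAt-+ {qT} {λ _ → 0} {closingTwist m t₀} j
                              | dec-true (j <? m ∸ 1) (≤-pred (subst (suc j <_) (sym (suc-pred m {{>-nonZero (<-trans z<s j+1<m)}})) j+1<m))
                              | δ-root j<m | δ-root j+1<m =
          trans (cong (_% n) (+-identityʳ (cyclePotential (suc j)))) (cyclePotential-step j+1<m)
        ... | no j+1≮m rewrite EG≡ | cycleEdges-last R (trans (last j+1≮m) (sym length-R))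
                             | joinAt-+ {qT} {λ _ → s} {cycleStep} j | joinAt-+ {qT} {λ _ → 0} {closingTwist m t₀} j
                             | dec-false (j <? m ∸ 1) (≤⇒≯ (≤-reflexive (cong pred (sym (last j+1≮m)))))
                             | δ-root j<m | δ-root (≤-<-trans z≤n j<m) | cong pred (last j+1≮m) = closing

-- The covers nG → G and G^n → G

module Lifts (s : ℕ) {p : ℕ} where
  open OddModulus s
  open Lifting s

  copiesLift : ∀ {twistOf} → (∀ e → twistOf e ≡ 0) → ∀ EG → CyclicLift p twistOf EG (repeatShifted shift n p EG)
  copiesLift untwisted [] = record
    { baseOf = λ _ → 0 ; blockOf = λ _ → 0 ; ecount≡ = length-repeatShifted shift n p []
    ; baseOf< = λ e< → ⊥-elim (no-edge e<) ; blockOf< = λ e< → ⊥-elim (no-edge e<)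
    ; source≡ = λ e< → ⊥-elim (no-edge e<) ; target≡ = λ e< → ⊥-elim (no-edge e<)
    ; block-base-injective = λ e< _ → ⊥-elim (no-edge e<) }
    where
    no-edge : ∀ {e} → e < length (repeatShifted shift n p []) → ⊥
    no-edge {e} e< = <⇒≱ e< (subst (_≤ e) (sym (trans (length-repeatShifted shift n p []) (*-zeroʳ n))) z≤n)
  copiesLift {twistOf} untwisted EG@(_ ∷ _) = record
    { baseOf = _% q ; blockOf = _/ q ; ecount≡ = length-repeatShifted shift n p EG
    ; baseOf< = λ {e} _ → m%n<n e q ; blockOf< = blockOf<
    ; source≡ = λ e< → cong proj₁ (lifted e<)
    ; target≡ = λ {e} e< → trans (cong proj₂ (lifted e<)) (cong (λ b → b * p + proj₂ (EG ! (e % q))) (sym (untwisted-block e<)))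
    ; block-base-injective = λ {e} {e′} _ _ b≡ j≡ →
        trans (m≡[m/n]*n+m%n e q) (trans (cong₂ (λ b j → b * q + j) b≡ j≡) (sym (m≡[m/n]*n+m%n e′ q))) }
    where
    q = length EG
    EH = repeatShifted shift n p EG
    blockOf< : ∀ {e} → e < length EH → e / q < n
    blockOf< {e} e< = m<n*o⇒m/o<n (subst (e <_) (length-repeatShifted shift n p EG) e<)
    lifted : ∀ {e} → e < length EH → EH ! e ≡ shift ((e / q) * p) (EG ! (e % q))
    lifted {e} e< = trans (cong (EH !_) (m≡[m/n]*n+m%n e q)) (nth-repeatShifted-edges n p EG (blockOf< e<) (m%n<n e q))
    untwisted-block : ∀ {e} → e < length EH → (e / q + twistOf (e % q)) % n ≡ e / q
    untwisted-block {e} e< = trans (cong (λ t → (e / q + t) % n) (untwisted (e % q)))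
                                   (trans (cong (_% n) (+-identityʳ (e / q))) (m<n⇒m%n≡m (blockOf< e<)))

  -- The closing edge of the b-th copy of the cycle leads into the (b + 1)-th copy, modulo n.
  cycleLift : ∀ R {m} .{{_ : NonZero m}} → length R ≡ m →
              CyclicLift p (closingTwist m 1) (cycleEdges R) (cycleEdges (repeatShifted _+_ n p R))
  cycleLift R {m} |R|≡m = record
    { baseOf = _% m ; blockOf = _/ m
    ; ecount≡ = trans (length-cycleEdges RL) (trans |RL|≡ (cong (n *_) (sym (trans (length-cycleEdges R) |R|≡m))))
    ; baseOf< = λ {e} _ → subst (e % m <_) (sym (trans (length-cycleEdges R) |R|≡m)) (m%n<n e m)
    ; blockOf< = λ e< → m<n*o⇒m/o<n (e<nm e<)
    ; source≡ = source≡ ; target≡ = target≡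
    ; block-base-injective = λ {e} {e′} _ _ b≡ j≡ →
        trans (m≡[m/n]*n+m%n e m) (trans (cong₂ (λ b j → b * m + j) b≡ j≡) (sym (m≡[m/n]*n+m%n e′ m))) }
    where
    instance
      nm≢0 : NonZero (n * m)
      nm≢0 = m*n≢0 n m
    RL = repeatShifted _+_ n p R
    |RL|≡ : length RL ≡ n * m
    |RL|≡ = trans (length-repeatShifted _+_ n p R) (cong (n *_) |R|≡m)
    e<nm : ∀ {e} → e < length (cycleEdges RL) → e < n * m
    e<nm {e} e< = subst (e <_) (trans (length-cycleEdges RL) |RL|≡) e<
    j<R : ∀ e → e % m < length R
    j<R e = subst (e % m <_) (sym |R|≡m) (m%n<n e m)
    RL-at : ∀ {b j} → b < n → j < m → RL !ₙ (b * m + j) ≡ b * p + R !ₙ j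
    RL-at {b} {j} b<n j<m = subst (λ l → RL !ₙ (b * l + j) ≡ b * p + R !ₙ j) |R|≡m
                                  (nth-repeatShifted-ℕ n p R b<n (subst (j <_) (sym |R|≡m) j<m))
    source≡ : ∀ {e} → e < length (cycleEdges RL) → proj₁ (cycleEdges RL ! e) ≡ (e / m) * p + proj₁ (cycleEdges R ! (e % m))
    source≡ {e} e< = begin
      proj₁ (cycleEdges RL ! e)                      ≡⟨ cycleEdges-source RL (subst (e <_) (length-cycleEdges RL) e<) ⟩
      RL !ₙ e                                        ≡⟨ cong (RL !ₙ_) (m≡[m/n]*n+m%n e m) ⟩
      RL !ₙ ((e / m) * m + e % m)                    ≡⟨ RL-at (m<n*o⇒m/o<n (e<nm e<)) (m%n<n e m) ⟩
      (e / m) * p + R !ₙ (e % m)                     ≡⟨ cong ((e / m) * p +_) (cycleEdges-source R (j<R e)) ⟨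
      (e / m) * p + proj₁ (cycleEdges R ! (e % m))   ∎
      where open ≡-Reasoning
    next-index : ∀ {e} → e < n * m → suc e % (n * m) ≡ ((e / m + closingTwist m 1 (e % m)) % n) * m + suc (e % m) % m
    next-index {e} e< with suc (e % m) <? m
    ... | yes j+1<m rewrite dec-true (e % m <? m ∸ 1) (≤-pred (subst (suc (e % m) <_) (sym (suc-pred m)) j+1<m)) = begin
      suc e % (n * m)                    ≡⟨ m<n⇒m%n≡m (subst (_< n * m) (sym suc-e≡) (m*n+o<k*n {k = n} (m<n*o⇒m/o<n e<) j+1<m)) ⟩
      suc e                              ≡⟨ suc-e≡ ⟩
      (e / m) * m + suc (e % m)          ≡⟨ cong₂ (λ b j → b * m + j) (sym (trans (cong (_% n) (+-identityʳ (e / m))) (m<n⇒m%n≡m (m<n*o⇒m/o<n e<))))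
                                                                     (sym (m<n⇒m%n≡m j+1<m)) ⟩
      ((e / m + 0) % n) * m + suc (e % m) % m ∎
      where open ≡-Reasoning
            suc-e≡ : suc e ≡ (e / m) * m + suc (e % m)
            suc-e≡ = trans (cong suc (m≡[m/n]*n+m%n e m)) (sym (+-suc _ _))
    ... | no j+1≮m rewrite dec-false (e % m <? m ∸ 1) (≤⇒≯ (≤-reflexive (cong pred (sym (≤-antisym (m%n<n e m) (≮⇒≥ j+1≮m)))))) = begin
      suc e % (n * m)                    ≡⟨ cong (_% (n * m)) suc-e≡ ⟩
      suc (e / m) * m % (n * m)          ≡⟨ m%n*o≡m*o%[n*o] (suc (e / m)) n m ⟨
      (suc (e / m) % n) * m              ≡⟨ +-identityʳ _ ⟨
      (suc (e / m) % n) * m + 0          ≡⟨ cong₂ (λ b j → b % n * m + j) (+-comm 1 (e / m)) (sym (trans (%-congˡ j+1≡m) (n%n≡0 m))) ⟩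
      ((e / m + 1) % n) * m + suc (e % m) % m ∎
      where open ≡-Reasoning
            j+1≡m : suc (e % m) ≡ m
            j+1≡m = ≤-antisym (m%n<n e m) (≮⇒≥ j+1≮m)
            suc-e≡ : suc e ≡ suc (e / m) * m
            suc-e≡ = trans (cong suc (m≡[m/n]*n+m%n e m)) (trans (sym (+-suc _ _)) (trans (cong ((e / m) * m +_) j+1≡m) (+-comm _ m)))
    target≡ : ∀ {e} → e < length (cycleEdges RL) →
              proj₂ (cycleEdges RL ! e) ≡ ((e / m + closingTwist m 1 (e % m)) % n) * p + proj₂ (cycleEdges R ! (e % m))
    target≡ {e} e< = begin
      proj₂ (cycleEdges RL ! e)                   ≡⟨ cycleEdges-target RL |RL|≡ (e<nm e<) ⟩
      RL !ₙ (suc e % (n * m))                     ≡⟨ cong (RL !ₙ_) (next-index (e<nm e<)) ⟩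
      RL !ₙ (b′ * m + suc (e % m) % m)            ≡⟨ RL-at (m%n<n (e / m + closingTwist m 1 (e % m)) n) (m%n<n (suc (e % m)) m) ⟩
      b′ * p + R !ₙ (suc (e % m) % m)             ≡⟨ cong (b′ * p +_) (cycleEdges-target R |R|≡m (m%n<n e m)) ⟨
      b′ * p + proj₂ (cycleEdges R ! (e % m))     ∎
      where open ≡-Reasoning
            b′ = (e / m + closingTwist m 1 (e % m)) % n

  _++ᴸ_ : ∀ {tw₁ tw₂ EG₁ EG₂ EH₁ EH₂} → CyclicLift p tw₁ EG₁ EH₁ → CyclicLift p tw₂ EG₂ EH₂ →
          CyclicLift p (joinAt (length EG₁) tw₁ tw₂) (EG₁ ++ EG₂) (EH₁ ++ EH₂)
  _++ᴸ_ {tw₁} {tw₂} {EG₁} {EG₂} {EH₁} {EH₂} L₁ L₂ = record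
    { baseOf = baseOf ; blockOf = blockOf
    ; ecount≡ = trans (length-++ EH₁) (trans (cong₂ _+_ L₁.ecount≡ L₂.ecount≡)
                                              (trans (sym (*-distribˡ-+ n g₁ _)) (cong (n *_) (sym (length-++ EG₁)))))
    ; baseOf< = baseOf< ; blockOf< = blockOf< ; source≡ = source≡ ; target≡ = target≡
    ; block-base-injective = injective }
    where
    module L₁ = CyclicLift L₁
    module L₂ = CyclicLift L₂
    g₁ = length EG₁
    h₁ = length EH₁
    baseOf blockOf : ℕ → ℕ
    baseOf  = joinAt h₁ L₁.baseOf (λ e → g₁ + L₂.baseOf e)
    blockOf = joinAt h₁ L₁.blockOf L₂.blockOf

    data Part (e : ℕ) : Set where
      part₁ : e < h₁ → baseOf e ≡ L₁.baseOf e → blockOf e ≡ L₁.blockOf e → Part e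
      part₂ : ∀ e′ → e′ < length EH₂ → e ≡ h₁ + e′ → baseOf e ≡ g₁ + L₂.baseOf e′ → blockOf e ≡ L₂.blockOf e′ → Part e

    part : ∀ {e} → e < length (EH₁ ++ EH₂) → Part e
    part {e} e< with side h₁ (length EH₂) (subst (e <_) (length-++ EH₁) e<)
    ... | first q = part₁ q (joinAt-< {h₁} {L₁.baseOf} {λ e → g₁ + L₂.baseOf e} q) (joinAt-< {h₁} {L₁.blockOf} {L₂.blockOf} q)
    ... | second e′ q refl = part₂ e′ q refl (joinAt-+ {h₁} {L₁.baseOf} {λ e → g₁ + L₂.baseOf e} e′) (joinAt-+ {h₁} {L₁.blockOf} {L₂.blockOf} e′)

    baseOf< : ∀ {e} → e < length (EH₁ ++ EH₂) → baseOf e < length (EG₁ ++ EG₂)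
    baseOf< e< with part e<
    ... | part₁ q b≡ _ rewrite b≡ | length-++ EG₁ {EG₂} = ≤-trans (L₁.baseOf< q) (m≤m+n g₁ _)
    ... | part₂ e′ q refl b≡ _ rewrite b≡ | length-++ EG₁ {EG₂} = +-monoʳ-< g₁ (L₂.baseOf< q)

    blockOf< : ∀ {e} → e < length (EH₁ ++ EH₂) → blockOf e < n
    blockOf< e< with part e<
    ... | part₁ q _ k≡ rewrite k≡ = L₁.blockOf< q
    ... | part₂ e′ q refl _ k≡ rewrite k≡ = L₂.blockOf< q

    source≡ : ∀ {e} → e < length (EH₁ ++ EH₂) → proj₁ ((EH₁ ++ EH₂) ! e) ≡ blockOf e * p + proj₁ ((EG₁ ++ EG₂) ! baseOf e)
    source≡ e< with part e<
    ... | part₁ q b≡ k≡ rewrite b≡ | k≡ | nth-++ˡ {d = 0 , 0} EH₁ EH₂ q | nth-++ˡ {d = 0 , 0} EG₁ EG₂ (L₁.baseOf< q) = L₁.source≡ q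
    ... | part₂ e′ q refl b≡ k≡ rewrite b≡ | k≡ | nth-++ʳ {d = 0 , 0} EH₁ EH₂ e′ | nth-++ʳ {d = 0 , 0} EG₁ EG₂ (L₂.baseOf e′) = L₂.source≡ q

    target≡ : ∀ {e} → e < length (EH₁ ++ EH₂) →
              proj₂ ((EH₁ ++ EH₂) ! e) ≡ ((blockOf e + joinAt g₁ tw₁ tw₂ (baseOf e)) % n) * p + proj₂ ((EG₁ ++ EG₂) ! baseOf e)
    target≡ e< with part e<
    ... | part₁ q b≡ k≡ rewrite b≡ | k≡ | nth-++ˡ {d = 0 , 0} EH₁ EH₂ q | nth-++ˡ {d = 0 , 0} EG₁ EG₂ (L₁.baseOf< q)
                              | joinAt-< {g₁} {tw₁} {tw₂} (L₁.baseOf< q) = L₁.target≡ q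
    ... | part₂ e′ q refl b≡ k≡ rewrite b≡ | k≡ | nth-++ʳ {d = 0 , 0} EH₁ EH₂ e′ | nth-++ʳ {d = 0 , 0} EG₁ EG₂ (L₂.baseOf e′)
                                    | joinAt-+ {g₁} {tw₁} {tw₂} (L₂.baseOf e′) = L₂.target≡ q

    injective : ∀ {e e′} → e < length (EH₁ ++ EH₂) → e′ < length (EH₁ ++ EH₂) → blockOf e ≡ blockOf e′ → baseOf e ≡ baseOf e′ → e ≡ e′
    injective e< e′< k≡ b≡ with part e< | part e′<
    ... | part₁ q b₁ k₁ | part₁ q′ b₁′ k₁′ =
      L₁.block-base-injective q q′ (trans (sym k₁) (trans k≡ k₁′)) (trans (sym b₁) (trans b≡ b₁′))
    ... | part₂ x q refl b₂ k₂ | part₂ x′ q′ refl b₂′ k₂′ = cong (h₁ +_)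
      (L₂.block-base-injective q q′ (trans (sym k₂) (trans k≡ k₂′)) (+-cancelˡ-≡ g₁ _ _ (trans (sym b₂) (trans b≡ b₂′))))
    ... | part₁ q b₁ _ | part₂ x′ q′ refl b₂′ _ =
      ⊥-elim (<⇒≱ (L₁.baseOf< q) (subst (g₁ ≤_) (sym (trans (sym b₁) (trans b≡ b₂′))) (m≤m+n g₁ _)))
    ... | part₂ x q refl b₂ _ | part₁ q′ b₁′ _ =
      ⊥-elim (<⇒≱ (L₁.baseOf< q′) (subst (g₁ ≤_) (trans (sym b₂) (trans b≡ b₁′)) (m≤m+n g₁ _)))

module UnicyclicCovers (s : ℕ) (ts : List Tree) (3≤m : 3 ≤ length ts) where
  open OddModulus s
  open Covering s
  open Lifting s
  open Lifts s

  private
    0<m : 0 < length ts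
    0<m = ≤-trans (s≤s z≤n) 3≤m

    instance
      p≢0 : NonZero (fsize ts)
      p≢0 = fsize-nonZero ts 0<m
      m≢0 : NonZero (length ts)
      m≢0 = >-nonZero 0<m

    cycleGraph-wellFormed : WellFormed (cycleGraph ts)
    cycleGraph-wellFormed = subst WellFormed (toℕGraph-unicyclic ts) (toℕGraph-wellFormed (unicyclic ts))

  module _ (P c₀ : ℕ) where
    open CyclePotential s ts P c₀ 0 1

    copiesCover : s * (m ∸ 1) ≤ D → (cyclePotential 0 + 0 * 1) % n ≡ (cyclePotential (m ∸ 1) + cycleStep (m ∸ 1)) % n →
                  Cover (toℕGraph (copies n (unicyclic ts))) (toℕGraph (unicyclic ts))
    copiesCover D-large closing = subst₂ Cover H≡ (sym (toℕGraph-unicyclic ts))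
      (PotentialCover.cover (copiesLift untwisted EG) cycleGraph-wellFormed 1 mulInjective-1 δ step (λ {e} _ → step-half e)
                            (potential D-large closing))
      where
      untwisted : ∀ e → twistOf e ≡ 0
      untwisted e with does (e <? qT)
      ... | true = refl
      ... | false with does (e ∸ qT <? m ∸ 1)
      ...   | true  = refl
      ...   | false = refl
      H≡ : ℕgraph (n * p) (repeatShifted shift n p EG) ≡ toℕGraph (copies n (unicyclic ts))
      H≡ = sym (trans (toℕGraph-copies n (unicyclic ts))
                      (cong (λ Γ → ℕgraph (n * p) (repeatShifted shift n p (elist Γ))) (toℕGraph-unicyclic ts)))

  module _ (P c₀ A : ℕ) (A-injective : MulInjective A) where
    open CyclePotential s ts P c₀ 1 A

    powerCover : s * (m ∸ 1) ≤ D → (cyclePotential 0 + 1 * A) % n ≡ (cyclePotential (m ∸ 1) + cycleStep (m ∸ 1)) % n →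
                 Cover (toℕGraph (unicyclicPow n ts)) (toℕGraph (unicyclic ts))
    powerCover D-large closing = subst₂ Cover H≡ (sym (toℕGraph-unicyclic ts))
      (PotentialCover.cover (copiesLift (λ _ → refl) (forestEdgesℕ ts) ++ᴸ cycleLift R (length-rootsℕ ts))
                            cycleGraph-wellFormed A A-injective δ step (λ {e} _ → step-half e) (potential D-large closing))
      where
      H≡ : ℕgraph (n * p) (repeatShifted shift n p (forestEdgesℕ ts) ++ cycleEdges (repeatShifted _+_ n p R))
           ≡ toℕGraph (unicyclicPow n ts)
      H≡ = sym (trans (toℕGraph-unicyclic (power n ts))
                      (cong₂ ℕgraph (fsize-power n ts) (cong₂ (λ F Rs → F ++ cycleEdges Rs) (forestEdgesℕ-power n ts) (rootsℕ-power n ts))))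

  copiesCover-even : ∀ k → length ts ≡ suc (suc k) + suc (suc k) → Cover (toℕGraph (copies n (unicyclic ts))) (toℕGraph (unicyclic ts))
  copiesCover-even k m≡ = copiesCover P 0 D-large (%≡%-by-multiple n 0 1 (cong (_+ 0) cyclePotential-0) last≡)
    where
    P = suc (suc k)
    open CyclePotential s ts P 0 0 1
    j₀ = suc k + suc (suc k)
    P≤j₀ : P ≤ j₀
    P≤j₀ = s≤s (≤-trans (n≤1+n (suc k)) (m≤n+m (suc (suc k)) k))
    D-large : s * (m ∸ 1) ≤ D
    D-large = *-monoʳ-≤ s (≤-trans (m∸n≤m m 1) (≤-reflexive m≡))
    last≡ : cyclePotential (m ∸ 1) + cycleStep (m ∸ 1) ≡ 0 + 1 * n
    last≡ = begin
      cyclePotential (m ∸ 1) + cycleStep (m ∸ 1) ≡⟨ cong (λ j → cyclePotential j + cycleStep j) (cong (_∸ 1) m≡) ⟩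
      cyclePotential j₀ + cycleStep j₀            ≡⟨ cong₂ _+_ (cyclePotential-≥ P≤j₀) (cycleStep-≥ P≤j₀) ⟩
      D ∸ s * j₀ + suc s                          ≡⟨ cong (λ x → x ∸ s * j₀ + suc s) (ring s k) ⟩
      s + s * j₀ ∸ s * j₀ + suc s                 ≡⟨ cong (_+ suc s) (m+n∸n≡m s (s * j₀)) ⟩
      s + suc s                                   ≡⟨ ring′ s ⟩
      0 + 1 * n                                   ∎
      where open ≡-Reasoning
            ring : ∀ s k → 0 + s * (suc (suc k) + suc (suc k)) ≡ s + s * (suc k + suc (suc k))
            ring = solve-∀
            ring′ : ∀ s → s + suc s ≡ 0 + 1 * suc (s + s)
            ring′ = solve-∀

  copiesCover-n : length ts ≡ n → Cover (toℕGraph (copies n (unicyclic ts))) (toℕGraph (unicyclic ts))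
  copiesCover-n m≡ = copiesCover n 0 D-large (%≡%-by-multiple n 0 s (cong (_+ 0) cyclePotential-0) last≡)
    where
    open CyclePotential s ts n 0 0 1
    D-large : s * (m ∸ 1) ≤ D
    D-large = *-monoʳ-≤ s (≤-trans (m∸n≤m m 1) (≤-trans (≤-reflexive m≡) (m≤m+n n n)))
    last≡ : cyclePotential (m ∸ 1) + cycleStep (m ∸ 1) ≡ 0 + s * n
    last≡ = begin
      cyclePotential (m ∸ 1) + cycleStep (m ∸ 1) ≡⟨ cong (λ j → cyclePotential j + cycleStep j) (cong (_∸ 1) m≡) ⟩
      cyclePotential (s + s) + cycleStep (s + s)  ≡⟨ cong₂ _+_ (cyclePotential-≤ (n≤1+n _)) (cycleStep-< ≤-refl) ⟩
      0 + s * (s + s) + s                         ≡⟨ ring s ⟩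
      0 + s * n                                   ∎
      where open ≡-Reasoning
            ring : ∀ s → 0 + s * (s + s) + s ≡ 0 + s * suc (s + s)
            ring = solve-∀

  copiesCover-odd : ∀ g → length ts ≡ n + (suc g + suc g) → Cover (toℕGraph (copies n (unicyclic ts))) (toℕGraph (unicyclic ts))
  copiesCover-odd g m≡ = copiesCover P 0 D-large (%≡%-by-multiple n 0 (suc s) (cong (_+ 0) cyclePotential-0) last≡)
    where
    P = n + suc g
    open CyclePotential s ts P 0 0 1
    j₀ = (s + s) + (suc g + suc g)
    P≤j₀ : P ≤ j₀
    P≤j₀ = subst (P ≤_) (ring s g) (m≤m+n P g)
      where ring : ∀ s g → suc (s + s) + suc g + g ≡ (s + s) + (suc g + suc g)
            ring = solve-∀
    D-large : s * (m ∸ 1) ≤ D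
    D-large = *-monoʳ-≤ s (≤-trans (m∸n≤m m 1) (≤-trans (≤-reflexive m≡) (subst (n + (suc g + suc g) ≤_) (ring s g) (m≤m+n _ n))))
      where ring : ∀ s g → suc (s + s) + (suc g + suc g) + suc (s + s) ≡ suc (s + s) + suc g + (suc (s + s) + suc g)
            ring = solve-∀
    last≡ : cyclePotential (m ∸ 1) + cycleStep (m ∸ 1) ≡ 0 + suc s * n
    last≡ = begin
      cyclePotential (m ∸ 1) + cycleStep (m ∸ 1) ≡⟨ cong (λ j → cyclePotential j + cycleStep j) (cong (_∸ 1) m≡) ⟩
      cyclePotential j₀ + cycleStep j₀            ≡⟨ cong₂ _+_ (cyclePotential-≥ P≤j₀) (cycleStep-≥ P≤j₀) ⟩
      D ∸ s * j₀ + suc s                          ≡⟨ cong (λ x → x ∸ s * j₀ + suc s) (ring s g) ⟩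
      s * j₀ + s * suc n ∸ s * j₀ + suc s         ≡⟨ cong (_+ suc s) (m+n∸m≡n (s * j₀) (s * suc n)) ⟩
      s * suc n + suc s                           ≡⟨ ring′ s ⟩
      0 + suc s * n                               ∎
      where open ≡-Reasoning
            ring : ∀ s g → 0 + s * (suc (s + s) + suc g + (suc (s + s) + suc g)) ≡ s * ((s + s) + (suc g + suc g)) + s * suc (suc (s + s))
            ring = solve-∀
            ring′ : ∀ s → s * suc (suc (s + s)) + suc s ≡ 0 + suc s * suc (s + s)
            ring′ = solve-∀

  powerCover-odd : ∀ h → length ts ≡ suc (suc h + suc h) → Cover (toℕGraph (unicyclicPow n ts)) (toℕGraph (unicyclic ts))
  powerCover-odd h m≡ = powerCover P 0 s mulInjective-s D-large (%≡%-by-multiple n s 1 (trans (cong (_+ 1 * s) cyclePotential-0) (+-identityʳ s)) last≡)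
    where
    P = suc (suc h)
    open CyclePotential s ts P 0 1 s
    j₀ = suc h + suc h
    P≤j₀ : P ≤ j₀
    P≤j₀ = s≤s (m≤n+m (suc h) h)
    D-large : s * (m ∸ 1) ≤ D
    D-large = *-monoʳ-≤ s (≤-trans (≤-reflexive (cong (_∸ 1) m≡)) (subst (j₀ ≤_) (ring h) (m≤m+n j₀ 2)))
      where ring : ∀ h → suc h + suc h + 2 ≡ suc (suc h) + suc (suc h)
            ring = solve-∀
    last≡ : cyclePotential (m ∸ 1) + cycleStep (m ∸ 1) ≡ s + 1 * n
    last≡ = begin
      cyclePotential (m ∸ 1) + cycleStep (m ∸ 1) ≡⟨ cong (λ j → cyclePotential j + cycleStep j) (cong (_∸ 1) m≡) ⟩
      cyclePotential j₀ + cycleStep j₀            ≡⟨ cong₂ _+_ (cyclePotential-≥ P≤j₀) (cycleStep-≥ P≤j₀) ⟩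
      D ∸ s * j₀ + suc s                          ≡⟨ cong (λ x → x ∸ s * j₀ + suc s) (ring s h) ⟩
      s * j₀ + (s + s) ∸ s * j₀ + suc s           ≡⟨ cong (_+ suc s) (m+n∸m≡n (s * j₀) (s + s)) ⟩
      s + s + suc s                               ≡⟨ ring′ s ⟩
      s + 1 * n                                   ∎
      where open ≡-Reasoning
            ring : ∀ s h → 0 + s * (suc (suc h) + suc (suc h)) ≡ s * (suc h + suc h) + (s + s)
            ring = solve-∀
            ring′ : ∀ s → s + s + suc s ≡ s + 1 * suc (s + s)
            ring′ = solve-∀

  powerCover-even : ∀ k → length ts ≡ suc k + suc k → Cover (toℕGraph (unicyclicPow n ts)) (toℕGraph (unicyclic ts))
  powerCover-even k m≡ = powerCover k s 1 mulInjective-1 D-large (%≡%-by-multiple n (suc s) 0 (trans (cong (_+ 1 * 1) cyclePotential-0) (+-comm s 1)) last≡)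
    where
    open CyclePotential s ts k s 1 1
    j₀ = k + suc k
    D≡ : D ≡ s * j₀
    D≡ = ring s k
      where ring : ∀ s k → s + s * (k + k) ≡ s * (k + suc k)
            ring = solve-∀
    D-large : s * (m ∸ 1) ≤ D
    D-large = ≤-reflexive (trans (cong (λ x → s * (x ∸ 1)) m≡) (sym D≡))
    last≡ : cyclePotential (m ∸ 1) + cycleStep (m ∸ 1) ≡ suc s + 0 * n
    last≡ = begin
      cyclePotential (m ∸ 1) + cycleStep (m ∸ 1) ≡⟨ cong (λ j → cyclePotential j + cycleStep j) (cong (_∸ 1) m≡) ⟩
      cyclePotential j₀ + cycleStep j₀            ≡⟨ cong₂ _+_ (cyclePotential-≥ (m≤m+n k (suc k))) (cycleStep-≥ (m≤m+n k (suc k))) ⟩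
      D ∸ s * j₀ + suc s                          ≡⟨ cong (λ x → x ∸ s * j₀ + suc s) D≡ ⟩
      s * j₀ ∸ s * j₀ + suc s                     ≡⟨ cong (_+ suc s) (n∸n≡0 (s * j₀)) ⟩
      suc s                                       ≡⟨ +-identityʳ (suc s) ⟨
      suc s + 0 * n                               ∎
      where open ≡-Reasoning

  cover-copies : (length ts % 2 ≡ 1 → n ≤ length ts) →
                 Cover (toℕGraph (copies n (unicyclic ts))) (toℕGraph (unicyclic ts))
  cover-copies n≤m with evenOdd (length ts)
  ... | even 0 m≡ with subst (3 ≤_) m≡ 3≤m
  ...   | ()
  cover-copies n≤m | even 1 m≡ with subst (3 ≤_) m≡ 3≤m
  ...   | s≤s (s≤s ())
  cover-copies n≤m | even (suc (suc k)) m≡ = copiesCover-even k m≡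
  cover-copies n≤m | odd h m≡ with m≤n⇒∃[o]m+o≡n s≤h
    where s≤h : s ≤ h
          s≤h = m+m≤n+n⇒m≤n (≤-pred (subst (n ≤_) m≡ (n≤m (subst (λ x → x % 2 ≡ 1) (sym m≡) ([1+h+h]%2≡1 h)))))
  ... | zero , refl = copiesCover-n (trans m≡ (cong suc (cong₂ _+_ (+-identityʳ s) (+-identityʳ s))))
  ... | suc g , refl = copiesCover-odd g (trans m≡ (ring s g))
    where ring : ∀ s g → suc ((s + suc g) + (s + suc g)) ≡ suc (s + s) + (suc g + suc g)
          ring = solve-∀

  cover-power : Cover (toℕGraph (unicyclicPow n ts)) (toℕGraph (unicyclic ts))
  cover-power with evenOdd (length ts)
  ... | even 0 m≡ with subst (3 ≤_) m≡ 3≤m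
  ...   | ()
  cover-power | odd 0 m≡ with subst (3 ≤_) m≡ 3≤m
  ...   | s≤s ()
  cover-power | even (suc k) m≡ = powerCover-even k m≡
  cover-power | odd (suc h) m≡ = powerCover-odd h m≡

theorem4p3 : (n : ℕ) → n % 2 ≡ 1 →
    (l : ℕ) (Ts : Fin l → List Tree) →
    (∀ i → 3 ≤ length (Ts i)) →
    (J : Subset l) →
    (∀ i → i ∈ J → length (Ts i) % 2 ≡ 1 → n ≤ length (Ts i)) →
    (EdgeMagicLabeling (sumGraph l Ts) → EdgeMagicLabeling (combined n l Ts J))
    × (SuperEdgeMagicLabeling (sumGraph l Ts) → SuperEdgeMagicLabeling (combined n l Ts J))
theorem4p3 n n-odd l Ts 3≤m J n≤m with m%2≡1⇒m≡1+h+h {n} n-odd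
... | s , refl = liftEdgeMagic , liftSuperEdgeMagic
  where
  open Covering s
  open CoverSum s J (λ i → unicyclic (Ts i)) (λ i → copies n (unicyclic (Ts i))) (λ i → unicyclicPow n (Ts i))
  open UnicyclicCovers using (cover-copies; cover-power)
  cover : Cover (toℕGraph (combined n l Ts J)) (toℕGraph (sumGraph l Ts))
  cover = sumCover (λ i i∈J → cover-copies s (Ts i) (3≤m i) (n≤m i i∈J)) (λ i _ → cover-power s (Ts i) (3≤m i)) (allFin l)
  open Lift cover
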